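{- For all integers $L,M\geq 0$, \[ \sum_{j\in\mathbb{Z}}(-1)^j q^{\frac{1}{2}j(5j+3)} \left[{L+M+j\atop M-j-1}\right]\left[{L+M-j\atop M+j}\right] =\sum_{n\geq 0}q^{n(n+1)}\left[{2L+M-n\atop 2L+1}\right]\left[{L\atop n}\right]. \]
   Context: $(x)_n=(x;q)_n=\prod_{i=0}^{n-1}(1-xq^i)$ for $n\in\mathbb{Z}_{\geq0}$; $\left[{n\atop m}\right]=\frac{(q)_n}{(q)_m(q)_{n-m}}$ if $m,n-m\in\mathbb{Z}_{\geq 0}$ and $0$ otherwise. -}

module Defs where

open import Level using (Level)
open import Data.Nat as ℕ using (ℕ; zero; suc; _≤ᵇ_)
import Data.Nat.Properties as ℕP
open import Data.Integer as ℤ using (ℤ; +_; -[1+_]; ∣_∣)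
open import Data.Bool using (Bool; true; false; if_then_else_)
open import Algebra.Bundles using (CommutativeRing)

-- Everything is stated over an arbitrary commutative ring R with an element q.
-- (An identity of polynomials in Z[q] is the same as an identity valid for
--  every element q of every commutative ring.)
module Q {c ℓ : Level} (R : CommutativeRing c ℓ) (q : CommutativeRing.Carrier R) where
  open CommutativeRing R hiding (zero)

  pow : Carrier → ℕ → Carrier
  pow x zero = 1#
  pow x (suc n) = x * pow x n

  -- Gaussian binomial [n over m] for natural n, m, via the q-Pascal rule
  --   [n+1 over m+1] = [n over m] + q^(m+1) [n over m+1];
  -- it equals (q)_n / ((q)_m (q)_{n-m}) for m ≤ n and 0 for m > n.
  gaussℕ : ℕ → ℕ → Carrier
  gaussℕ n zero = 1#
  gaussℕ zero (suc m) = 0#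
  gaussℕ (suc n) (suc m) = gaussℕ n m + pow q (suc m) * gaussℕ n (suc m)

  -- Gaussian binomial with integer arguments: 0 unless m, n - m ≥ 0.
  gauss : ℤ → ℤ → Carrier
  gauss (+ n) (+ m) = gaussℕ n m
  gauss (+ n) -[1+ m ] = 0#
  gauss -[1+ n ] m = 0#

  sgn : ℤ → Carrier
  sgn j = if ℕ._%_ ∣ j ∣ 2 ℕ.≡ᵇ 0 then 1# else - 1#

  -- j(5j+3)/2, which is always a nonnegative integer
  expo : ℤ → ℕ
  expo j = ℕ._/_ ∣ j ℤ.* (ℤ.+ 5 ℤ.* j ℤ.+ ℤ.+ 3) ∣ 2

  sumSym : ℕ → (ℤ → Carrier) → Carrier
  sumSym K f = go (suc (K ℕ.+ K))
    where
    go : ℕ → Carrier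
    go zero = 0#
    go (suc i) = f (+ i ℤ.- + K) + go i

  sumTo : ℕ → (ℕ → Carrier) → Carrier
  sumTo zero f = f zero
  sumTo (suc K) f = f (suc K) + sumTo K f

  lhsTerm : ℕ → ℕ → ℤ → Carrier
  lhsTerm L M j =
    sgn j * pow q (expo j)
      * gauss (+ L ℤ.+ + M ℤ.+ j) (+ M ℤ.- j ℤ.- + 1)
      * gauss (+ L ℤ.+ + M ℤ.- j) (+ M ℤ.+ j)

  rhsTerm : ℕ → ℕ → ℕ → Carrier
  rhsTerm L M n =
    pow q (n ℕ.* suc n)
      * gauss (+ (2 ℕ.* L ℕ.+ M) ℤ.- + n) (+ (2 ℕ.* L ℕ.+ 1))
      * gauss (+ L) (+ n)

-- Split the sum at j = p ≥ 0 and j = -(p+1), and write M = p + 1 + N. With s = 2p + 1 and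
-- {x, y} = {L, L + 1}, the two binomials of the summand are [x+s+N, N][y+N, N+s], and the convolution
--   [x+s+N, N][y+N, N+s] = Σ_{k+l=N} q^(k(k+s)) [x, k][y, k+s][x+y+l, l]
-- turns the summand into Σ_n q^(n(n+1)) [2L+M-n, 2L+1] w_j [L, n-j][L+1, n+j+1] with n = p + k,
-- where w_j = (-1)^j q^(j(3j+1)/2) is the pentagonal weight. After exchanging the sums it remains to
-- show Σ_j w_j [L, n-j][L+1, n+j+1] = [L, n]. The q-Pascal rule reduces this to
-- Σ_j w_j [L, n+j][L, n-j] = [L, n], the remaining terms cancelling in pairs. Finally q-Vandermonde
-- and trinomial revision give [L, n+j][L, n-j] = Σ_{k+m=n} q^(m²-j²) [L, 2m+k][2m+k, k][2m, m+j],
-- and Σ_j (-1)^j q^(j(j+1)/2) [2m, m+j] = δ_{m,0} by the q-binomial theorem.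

module Submission where

open import Level using (Level)
open import Algebra.Bundles using (CommutativeRing)
open import Data.Nat as ℕ using (ℕ; zero; suc; _≤_; _<_; s≤s)
import Data.Nat.Properties as ℕP
open import Data.Product using (_,_)
open import Relation.Binary.PropositionalEquality as P using (_≡_; _≢_)
open import Relation.Nullary using (Dec; yes; no)
open import Function using (_∘_)
open import Data.Nat.Tactic.RingSolver using (solve-∀)
import Data.Integer as ℤ
import Data.Integer.Properties as ℤP
import Data.Integer.Tactic.RingSolver as ℤ-Solver
import Data.Nat.DivMod as ℕD

import Algebra.Properties.CommutativeSemigroup

open import Defs

module Sums {r₁ r₂ : Level} (R : CommutativeRing r₁ r₂) where
  open CommutativeRing R hiding (zero)
  open import Algebra.Properties.Ring ring using (-‿+-comm; -0#≈0#)
  open import Relation.Binary.Reasoning.Setoid setoid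
  module +-CS = Algebra.Properties.CommutativeSemigroup +-commutativeSemigroup

  ∑ : ℕ → (ℕ → Carrier) → Carrier
  ∑ zero f = 0#
  ∑ (suc n) f = f n + ∑ n f

  ∑-unique : ∀ (f h : ℕ → Carrier) → h 0 ≡ 0# → (∀ m → h (suc m) ≡ f m + h m) → ∀ n → h n ≡ ∑ n f
  ∑-unique f h h0 hsuc zero = h0
  ∑-unique f h h0 hsuc (suc n) = P.trans (hsuc n) (P.cong (λ s → f n + s) (∑-unique f h h0 hsuc n))

  ∑-cong< : ∀ n {f g} → (∀ i → i < n → f i ≈ g i) → ∑ n f ≈ ∑ n g
  ∑-cong< zero f≈g = refl
  ∑-cong< (suc n) f≈g = +-cong (f≈g n ℕP.≤-refl) (∑-cong< n (λ i i<n → f≈g i (ℕP.m<n⇒m<1+n i<n)))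

  ∑-cong : ∀ n {f g} → (∀ i → f i ≈ g i) → ∑ n f ≈ ∑ n g
  ∑-cong n f≈g = ∑-cong< n (λ i _ → f≈g i)

  ∑-≈0 : ∀ n {f} → (∀ i → i < n → f i ≈ 0#) → ∑ n f ≈ 0#
  ∑-≈0 n f≈0 = trans (∑-cong< n f≈0) (∑0 n)
    where
    ∑0 : ∀ n → ∑ n (λ _ → 0#) ≈ 0#
    ∑0 zero = refl
    ∑0 (suc n) = trans (+-identityˡ _) (∑0 n)

  ∑-distrib-+ : ∀ n f g → ∑ n (λ i → f i + g i) ≈ ∑ n f + ∑ n g
  ∑-distrib-+ zero f g = sym (+-identityʳ 0#)
  ∑-distrib-+ (suc n) f g = begin
    (f n + g n) + ∑ n (λ i → f i + g i)  ≈⟨ +-congˡ (∑-distrib-+ n f g) ⟩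
    (f n + g n) + (∑ n f + ∑ n g)        ≈⟨ +-assoc _ _ _ ⟩
    f n + (g n + (∑ n f + ∑ n g))        ≈⟨ +-congˡ (+-CS.x∙yz≈y∙xz _ _ _) ⟩
    f n + (∑ n f + (g n + ∑ n g))        ≈⟨ +-assoc _ _ _ ⟨
    (f n + ∑ n f) + (g n + ∑ n g)        ∎

  *-distribˡ-∑ : ∀ n a f → a * ∑ n f ≈ ∑ n (λ i → a * f i)
  *-distribˡ-∑ zero a f = zeroʳ a
  *-distribˡ-∑ (suc n) a f = trans (distribˡ a _ _) (+-congˡ (*-distribˡ-∑ n a f))

  -‿distrib-∑ : ∀ n f → - ∑ n f ≈ ∑ n (λ i → - f i)
  -‿distrib-∑ zero f = -0#≈0#
  -‿distrib-∑ (suc n) f = trans (sym (-‿+-comm _ _)) (+-congˡ (-‿distrib-∑ n f))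

  ∑-first : ∀ n f → ∑ (suc n) f ≈ f 0 + ∑ n (λ i → f (suc i))
  ∑-first zero f = trans (+-identityʳ _) (sym (+-identityʳ _))
  ∑-first (suc n) f = trans (+-congˡ (∑-first n f)) (+-CS.x∙yz≈y∙xz _ _ _)

  ∑-split : ∀ m n f → ∑ (m ℕ.+ n) f ≈ ∑ m f + ∑ n (λ i → f (m ℕ.+ i))
  ∑-split m zero f = trans (reflexive (P.cong (λ k → ∑ k f) (ℕP.+-identityʳ m))) (sym (+-identityʳ _))
  ∑-split m (suc n) f = begin
    ∑ (m ℕ.+ suc n) f                                  ≡⟨ P.cong (λ k → ∑ k f) (ℕP.+-suc m n) ⟩
    f (m ℕ.+ n) + ∑ (m ℕ.+ n) f                         ≈⟨ +-congˡ (∑-split m n f) ⟩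
    f (m ℕ.+ n) + (∑ m f + ∑ n (λ i → f (m ℕ.+ i)))     ≈⟨ +-CS.x∙yz≈y∙xz _ _ _ ⟩
    ∑ m f + (f (m ℕ.+ n) + ∑ n (λ i → f (m ℕ.+ i)))     ∎

  ∑-trim : ∀ {m n} f → m ≤ n → (∀ i → m ≤ i → i < n → f i ≈ 0#) → ∑ n f ≈ ∑ m f
  ∑-trim {m} f m≤n f≈0 with ℕP.m≤n⇒∃[o]m+o≡n m≤n
  ... | o , P.refl = begin
    ∑ (m ℕ.+ o) f                      ≈⟨ ∑-split m o f ⟩
    ∑ m f + ∑ o (λ i → f (m ℕ.+ i))    ≈⟨ +-congˡ (∑-≈0 o (λ i i<o → f≈0 (m ℕ.+ i) (ℕP.m≤m+n m i) (ℕP.+-monoʳ-< m i<o))) ⟩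
    ∑ m f + 0#                         ≈⟨ +-identityʳ _ ⟩
    ∑ m f                              ∎

  ∑-window : ∀ n p m f → p ℕ.+ m ≤ n → (∀ i → i < p → f i ≈ 0#) → (∀ i → p ℕ.+ m ≤ i → f i ≈ 0#) →
             ∑ n f ≈ ∑ m (λ i → f (p ℕ.+ i))
  ∑-window n p m f p+m≤n below above = begin
    ∑ n f                                   ≈⟨ ∑-trim f p+m≤n (λ i p+m≤i _ → above i p+m≤i) ⟩
    ∑ (p ℕ.+ m) f                           ≈⟨ ∑-split p m f ⟩
    ∑ p f + ∑ m (λ i → f (p ℕ.+ i))         ≈⟨ +-congʳ (∑-≈0 p below) ⟩
    0# + ∑ m (λ i → f (p ℕ.+ i))            ≈⟨ +-identityˡ _ ⟩
    ∑ m (λ i → f (p ℕ.+ i))                 ∎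

  ∑-single : ∀ n k {f} → k < n → (∀ i → i < n → i ≢ k → f i ≈ 0#) → ∑ n f ≈ f k
  ∑-single (suc n) k {f} k<1+n f≈0 with k ℕ.≟ n
  ... | yes P.refl = trans (+-congˡ (∑-≈0 n (λ i i<n → f≈0 i (ℕP.m<n⇒m<1+n i<n) (ℕP.<⇒≢ i<n)))) (+-identityʳ _)
  ... | no k≢n = trans (+-congʳ (f≈0 n ℕP.≤-refl (k≢n ∘ P.sym)))
                   (trans (+-identityˡ _) (∑-single n k (ℕP.≤∧≢⇒< (ℕP.≤-pred k<1+n) k≢n) (λ i i<n → f≈0 i (ℕP.m<n⇒m<1+n i<n))))

  ∑-comm : ∀ m n (F : ℕ → ℕ → Carrier) → ∑ m (λ i → ∑ n (F i)) ≈ ∑ n (λ j → ∑ m (λ i → F i j))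
  ∑-comm zero n F = sym (∑-≈0 n (λ _ _ → refl))
  ∑-comm (suc m) n F = trans (+-congˡ (∑-comm m n F)) (sym (∑-distrib-+ n (F m) _))

  ∑-reverse : ∀ n f → ∑ n f ≈ ∑ n (λ i → f (n ℕ.∸ suc i))
  ∑-reverse zero f = refl
  ∑-reverse (suc n) f = trans (+-congˡ (∑-reverse n f)) (sym (∑-first n (λ i → f (suc n ℕ.∸ suc i))))

  conv : ℕ → (ℕ → ℕ → Carrier) → Carrier
  conv n F = ∑ (suc n) (λ k → F k (n ℕ.∸ k))

  conv-cong : ∀ n {F G} → (∀ k l → F k l ≈ G k l) → conv n F ≈ conv n G
  conv-cong n F≈G = ∑-cong (suc n) (λ k → F≈G k _)

  conv-first : ∀ n F → conv (suc n) F ≈ F 0 (suc n) + conv n (λ k l → F (suc k) l)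
  conv-first n F = ∑-first (suc n) _

module Arithmetic where
  open import Data.Nat using (_+_; _*_; _∸_)
  open import Data.Nat.DivMod using (_/_)
  open ℤ using (-[1+_]; ∣_∣)

  tri : ℕ → ℕ
  tri zero = zero
  tri (suc n) = suc n + tri n

  -- tri⊖ i c is the triangular number (i - c)(i - c + 1)/2 of the integer i - c.
  tri⊖ : ℕ → ℕ → ℕ
  tri⊖ i zero = tri i
  tri⊖ zero (suc c) = tri c
  tri⊖ (suc i) (suc c) = tri⊖ i c

  tri⊖-suc : ∀ i c → tri⊖ (suc i) c + c ≡ tri⊖ i c + suc i
  tri⊖-suc i zero = P.trans (ℕP.+-identityʳ _) (ℕP.+-comm (suc i) (tri i))
  tri⊖-suc zero (suc zero) = P.refl
  tri⊖-suc zero (suc (suc c)) = rearrange c (tri c)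
    where
    rearrange : ∀ c t → t + suc (suc c) ≡ suc c + t + 1
    rearrange = solve-∀
  tri⊖-suc (suc i) (suc c) =
    P.trans (ℕP.+-suc (tri⊖ (suc i) c) c) (P.trans (P.cong suc (tri⊖-suc i c)) (P.sym (ℕP.+-suc (tri⊖ i c) (suc i))))

  tri⊖-shift : ∀ i c n → i ≤ n → c ≤ suc n → tri⊖ (suc i) c + (n ∸ i) ≡ tri⊖ i c + (suc n ∸ c)
  tri⊖-shift i c n i≤n c≤1+n with ℕP.m≤n⇒∃[o]m+o≡n i≤n
  ... | r , P.refl = ℕP.+-cancelʳ-≡ c _ _ (begin
    tri⊖ (suc i) c + (i + r ∸ i) + c   ≡⟨ P.cong (λ z → tri⊖ (suc i) c + z + c) (ℕP.m+n∸m≡n i r) ⟩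
    tri⊖ (suc i) c + r + c             ≡⟨ swap (tri⊖ (suc i) c) r c ⟩
    tri⊖ (suc i) c + c + r             ≡⟨ P.cong (_+ r) (tri⊖-suc i c) ⟩
    tri⊖ i c + suc i + r               ≡⟨ ℕP.+-assoc (tri⊖ i c) (suc i) r ⟩
    tri⊖ i c + suc (i + r)             ≡⟨ P.cong (tri⊖ i c +_) (ℕP.m∸n+n≡m c≤1+n) ⟨
    tri⊖ i c + (suc (i + r) ∸ c + c)   ≡⟨ ℕP.+-assoc (tri⊖ i c) _ c ⟨
    tri⊖ i c + (suc (i + r) ∸ c) + c   ∎)
    where
    open P.≡-Reasoning
    swap : ∀ x y z → x + y + z ≡ x + z + y
    swap = solve-∀

  tri⊖-≥ : ∀ c p → tri⊖ (c + p) c ≡ tri p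
  tri⊖-≥ zero p = P.refl
  tri⊖-≥ (suc c) p = tri⊖-≥ c p

  tri⊖-< : ∀ i p → tri⊖ i (i + suc p) ≡ tri p
  tri⊖-< zero p = P.refl
  tri⊖-< (suc i) p = tri⊖-< i p

  n+p≤2[n∸k]+k : ∀ {n p k} → k ≤ n → p ≤ n ∸ k → n + p ≤ n ∸ k + (n ∸ k) + k
  n+p≤2[n∸k]+k {n} {p} {k} k≤n p≤n∸k = begin
    n + p                  ≡⟨ ℕP.+-comm n p ⟩
    p + n                  ≤⟨ ℕP.+-monoˡ-≤ n p≤n∸k ⟩
    n ∸ k + n              ≡⟨ P.cong ((n ∸ k) +_) (ℕP.m∸n+n≡m k≤n) ⟨
    n ∸ k + (n ∸ k + k)    ≡⟨ ℕP.+-assoc (n ∸ k) (n ∸ k) k ⟨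
    n ∸ k + (n ∸ k) + k    ∎
    where open ℕP.≤-Reasoning

  p*p+[m+p]*[m∸p]≡m*m : ∀ {p m} → p ≤ m → p * p + (m + p) * (m ∸ p) ≡ m * m
  p*p+[m+p]*[m∸p]≡m*m {p} p≤m with ℕP.m≤n⇒∃[o]m+o≡n p≤m
  ... | t , P.refl rewrite ℕP.m+n∸m≡n p t = square p t
    where
    square : ∀ p t → p * p + (p + t + p) * t ≡ (p + t) * (p + t)
    square = solve-∀

  pentagonal-exponent : ∀ {p n} t → p ≤ n → suc p * suc p + t + (n ∸ p) ≡ p * p + t + suc (n + p)
  pentagonal-exponent {p} t p≤n with ℕP.m≤n⇒∃[o]m+o≡n p≤n
  ... | u , P.refl rewrite ℕP.m+n∸m≡n p u = expand p u t
    where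
    expand : ∀ p u t → suc p * suc p + t + u ≡ p * p + t + suc (p + u + p)
    expand = solve-∀

  tri-double : ∀ p → tri p * 2 ≡ p * suc p
  tri-double zero = P.refl
  tri-double (suc p) = begin
    (suc p + tri p) * 2        ≡⟨ ℕP.*-distribʳ-+ 2 (suc p) (tri p) ⟩
    suc p * 2 + tri p * 2      ≡⟨ P.cong ((suc p * 2) +_) (tri-double p) ⟩
    suc p * 2 + p * suc p      ≡⟨ expand p ⟩
    suc p * suc (suc p)        ∎
    where
    open P.≡-Reasoning
    expand : ∀ p → suc p * 2 + p * suc p ≡ suc p * suc (suc p)
    expand = solve-∀

  -- j(5j+3)/2 = p(p+1) + j(3j+1)/2 for j = p and j = -(p+1).
  expo-+ : ∀ p → ∣ ℤ.+ p ℤ.* (ℤ.+ 5 ℤ.* ℤ.+ p ℤ.+ ℤ.+ 3) ∣ / 2 ≡ p * suc p + (p * p + tri p)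
  expo-+ p = P.trans (P.cong (_/ 2) (begin
    ∣ ℤ.+ p ℤ.* (ℤ.+ 5 ℤ.* ℤ.+ p ℤ.+ ℤ.+ 3) ∣              ≡⟨ ℤP.abs-* (ℤ.+ p) (ℤ.+ 5 ℤ.* ℤ.+ p ℤ.+ ℤ.+ 3) ⟩
    p * ∣ ℤ.+ 5 ℤ.* ℤ.+ p ℤ.+ ℤ.+ 3 ∣                    ≡⟨ P.cong (λ z → p * ∣ z ℤ.+ ℤ.+ 3 ∣) (ℤP.pos-* 5 p) ⟨
    p * (5 * p + 3)                                    ≡⟨ expand p ⟩
    p * suc p * 2 + p * p * 2 + p * suc p              ≡⟨ P.cong ((p * suc p * 2 + p * p * 2) +_) (tri-double p) ⟨
    p * suc p * 2 + p * p * 2 + tri p * 2              ≡⟨ collect p (tri p) ⟩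
    (p * suc p + (p * p + tri p)) * 2                  ∎)) (ℕD.m*n/n≡m _ 2)
    where
    open P.≡-Reasoning
    expand : ∀ p → p * (5 * p + 3) ≡ p * suc p * 2 + p * p * 2 + p * suc p
    expand = solve-∀
    collect : ∀ p t → p * suc p * 2 + p * p * 2 + t * 2 ≡ (p * suc p + (p * p + t)) * 2
    collect = solve-∀

  expo-[1+] : ∀ p → ∣ -[1+ p ] ℤ.* (ℤ.+ 5 ℤ.* -[1+ p ] ℤ.+ ℤ.+ 3) ∣ / 2 ≡ p * suc p + (suc p * suc p + tri p)
  expo-[1+] p = P.trans (P.cong (_/ 2) (begin
    ∣ -[1+ p ] ℤ.* (ℤ.+ 5 ℤ.* -[1+ p ] ℤ.+ ℤ.+ 3) ∣    ≡⟨ ℤP.abs-* -[1+ p ] (ℤ.+ 5 ℤ.* -[1+ p ] ℤ.+ ℤ.+ 3) ⟩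
    suc p * ∣ ℤ.+ 5 ℤ.* -[1+ p ] ℤ.+ ℤ.+ 3 ∣          ≡⟨ P.cong (λ z → suc p * ∣ z ∣) (negate (ℤ.+ p)) ⟩
    suc p * ∣ ℤ.- (ℤ.+ 5 ℤ.* ℤ.+ p ℤ.+ ℤ.+ 2) ∣          ≡⟨ P.cong (suc p *_) (ℤP.∣-i∣≡∣i∣ (ℤ.+ 5 ℤ.* ℤ.+ p ℤ.+ ℤ.+ 2)) ⟩
    suc p * ∣ ℤ.+ 5 ℤ.* ℤ.+ p ℤ.+ ℤ.+ 2 ∣                ≡⟨ P.cong (λ z → suc p * ∣ z ℤ.+ ℤ.+ 2 ∣) (ℤP.pos-* 5 p) ⟨
    suc p * (5 * p + 2)                                ≡⟨ expand p ⟩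
    p * suc p * 2 + suc p * suc p * 2 + p * suc p      ≡⟨ P.cong ((p * suc p * 2 + suc p * suc p * 2) +_) (tri-double p) ⟨
    p * suc p * 2 + suc p * suc p * 2 + tri p * 2      ≡⟨ collect p (tri p) ⟩
    (p * suc p + (suc p * suc p + tri p)) * 2          ∎)) (ℕD.m*n/n≡m _ 2)
    where
    open P.≡-Reasoning
    negate : ∀ x → ℤ.+ 5 ℤ.* ℤ.- (ℤ.+ 1 ℤ.+ x) ℤ.+ ℤ.+ 3 ≡ ℤ.- (ℤ.+ 5 ℤ.* x ℤ.+ ℤ.+ 2)
    negate = ℤ-Solver.solve-∀
    expand : ∀ p → suc p * (5 * p + 2) ≡ p * suc p * 2 + suc p * suc p * 2 + p * suc p
    expand = solve-∀
    collect : ∀ p t → p * suc p * 2 + suc p * suc p * 2 + t * 2 ≡ (p * suc p + (suc p * suc p + t)) * 2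
    collect = solve-∀

module QBinomials {r₁ r₂ : Level} (R : CommutativeRing r₁ r₂) (q : CommutativeRing.Carrier R) where
  open CommutativeRing R hiding (zero)
  open Q R q
  open Sums R
  open import Relation.Binary.Reasoning.Setoid setoid
  open import Algebra.Solver.Ring.NaturalCoefficients.Default commutativeSemiring
    using (solve; _:=_; _:+_; _:*_; con)

  infix 8 _C_
  _C_ : ℕ → ℕ → Carrier
  n C k = gaussℕ n k

  infix 9 q^_
  q^_ : ℕ → Carrier
  q^ n = pow q n

  q^-cong : ∀ {m n} → m ≡ n → q^ m ≈ q^ n
  q^-cong P.refl = refl

  q^-+ : ∀ m n → q^ (m ℕ.+ n) ≈ q^ m * q^ n
  q^-+ zero n = sym (*-identityˡ _)
  q^-+ (suc m) n = trans (*-congˡ (q^-+ m n)) (sym (*-assoc _ _ _))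

  C-cong : ∀ {n n′ k k′} → n ≡ n′ → k ≡ k′ → n C k ≈ n′ C k′
  C-cong P.refl P.refl = refl

  C-congˡ : ∀ n {k k′} → k ≡ k′ → n C k ≈ n C k′
  C-congˡ n P.refl = refl

  C-congʳ : ∀ {n n′} k → n ≡ n′ → n C k ≈ n′ C k
  C-congʳ k P.refl = refl

  C-above : ∀ {n k} → n < k → n C k ≈ 0#
  C-above {zero} {suc k} _ = refl
  C-above {suc n} {suc k} (s≤s n<k) = begin
    n C k + q^ suc k * n C suc k   ≈⟨ +-cong (C-above n<k) (*-congˡ (C-above (ℕP.m<n⇒m<1+n n<k))) ⟩
    0# + q^ suc k * 0#             ≈⟨ +-identityˡ _ ⟩
    q^ suc k * 0#                  ≈⟨ zeroʳ _ ⟩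
    0#                             ∎

  C-diag : ∀ n → n C n ≈ 1#
  C-diag zero = refl
  C-diag (suc n) = trans (+-cong (C-diag n) (trans (*-congˡ (C-above (ℕP.n<1+n n))) (zeroʳ _))) (+-identityʳ 1#)

  C-dual-pascal : ∀ a b → suc (a ℕ.+ b) C suc b ≈ q^ a * (a ℕ.+ b) C b + (a ℕ.+ b) C suc b
  C-dual-pascal zero b = begin
    suc b C suc b                  ≈⟨ C-diag (suc b) ⟩
    1#                             ≈⟨ +-identityʳ 1# ⟨
    1# + 0#                        ≈⟨ +-cong (trans (*-identityˡ _) (C-diag b)) (C-above (ℕP.n<1+n b)) ⟨
    q^ 0 * b C b + b C suc b       ∎
  C-dual-pascal (suc a) zero = begin
    1# + q^ 1 * suc (a ℕ.+ 0) C 1                    ≈⟨ +-congˡ (*-congˡ (C-dual-pascal a 0)) ⟩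
    1# + q^ 1 * (q^ a * 1# + (a ℕ.+ 0) C 1)          ≈⟨ rearrange q (q^ a) _ ⟩
    q^ suc a * 1# + (1# + q^ 1 * (a ℕ.+ 0) C 1)      ∎
    where
    rearrange : ∀ x y z → 1# + x * 1# * (y * 1# + z) ≈ x * y * 1# + (1# + x * 1# * z)
    rearrange = solve 3 (λ x y z → (con 1 :+ x :* con 1 :* (y :* con 1 :+ z)) := (x :* y :* con 1 :+ (con 1 :+ x :* con 1 :* z))) refl
  C-dual-pascal (suc a) (suc b) = begin
    suc (a ℕ.+ suc b) C suc b + q^ suc (suc b) * suc (a ℕ.+ suc b) C suc (suc b)
      ≈⟨ +-cong (trans (C-congʳ (suc b) (P.cong suc a+1+b)) (C-dual-pascal (suc a) b))
                (*-congˡ (trans (C-dual-pascal a (suc b)) (+-cong (*-congˡ (C-congʳ (suc b) a+1+b)) (C-congʳ (suc (suc b)) a+1+b)))) ⟩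
    (q^ suc a * n C b + n C suc b) + q^ suc (suc b) * (q^ a * n C suc b + n C suc (suc b))
      ≈⟨ rearrange q (q^ a) (q^ b) _ _ _ ⟩
    q^ suc a * (n C b + q^ suc b * n C suc b) + (n C suc b + q^ suc (suc b) * n C suc (suc b))
      ≈⟨ +-cong (*-congˡ (C-congʳ (suc b) (P.cong suc a+1+b))) (C-congʳ (suc (suc b)) (P.cong suc a+1+b)) ⟨
    q^ suc a * suc (a ℕ.+ suc b) C suc b + suc (a ℕ.+ suc b) C suc (suc b)
      ∎
    where
    n = suc (a ℕ.+ b)
    a+1+b : a ℕ.+ suc b ≡ n
    a+1+b = ℕP.+-suc a b
    rearrange : ∀ x y z u v w → (x * y * u + v) + x * (x * z) * (y * v + w) ≈ x * y * (u + x * z * v) + (v + x * (x * z) * w)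
    rearrange = solve 6 (λ x y z u v w → (x :* y :* u :+ v) :+ x :* (x :* z) :* (y :* v :+ w)
                                       := x :* y :* (u :+ x :* z :* v) :+ (v :+ x :* (x :* z) :* w)) refl

  C-sym : ∀ a b → (a ℕ.+ b) C a ≈ (a ℕ.+ b) C b
  C-sym zero b = sym (C-diag b)
  C-sym (suc a) zero = trans (C-congʳ (suc a) (P.cong suc (ℕP.+-identityʳ a))) (C-diag (suc a))
  C-sym (suc a) (suc b) = begin
    (a ℕ.+ suc b) C a + q^ suc a * (a ℕ.+ suc b) C suc a
      ≈⟨ +-cong (trans (C-sym a (suc b)) (C-congʳ (suc b) a+1+b)) (*-congˡ (trans (C-congʳ (suc a) a+1+b) (C-sym (suc a) b))) ⟩
    suc (a ℕ.+ b) C suc b + q^ suc a * suc (a ℕ.+ b) C b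
      ≈⟨ +-comm _ _ ⟩
    q^ suc a * suc (a ℕ.+ b) C b + suc (a ℕ.+ b) C suc b
      ≈⟨ trans (C-congʳ (suc b) (P.cong suc a+1+b)) (C-dual-pascal (suc a) b) ⟨
    suc (a ℕ.+ suc b) C suc b
      ∎
    where
    a+1+b : a ℕ.+ suc b ≡ suc (a ℕ.+ b)
    a+1+b = ℕP.+-suc a b

  C-revision : ∀ a b c → (a ℕ.+ b ℕ.+ c) C (a ℕ.+ b) * (a ℕ.+ b) C a ≈ (a ℕ.+ b ℕ.+ c) C a * (b ℕ.+ c) C b
  C-revision zero b c = trans (*-identityʳ _) (sym (*-identityˡ _))
  C-revision (suc a) zero c = begin
    (suc a ℕ.+ 0 ℕ.+ c) C (suc a ℕ.+ 0) * (suc a ℕ.+ 0) C suc a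
      ≈⟨ *-cong (C-congˡ (suc a ℕ.+ 0 ℕ.+ c) a+0≡a) (trans (C-congʳ (suc a) a+0≡a) (C-diag (suc a))) ⟩
    (suc a ℕ.+ 0 ℕ.+ c) C suc a * 1#
      ∎
    where a+0≡a = ℕP.+-identityʳ (suc a)
  C-revision (suc a) (suc b) zero = begin
    (n ℕ.+ 0) C n * n C suc a                 ≈⟨ *-congʳ (trans (C-congʳ n n+0≡n) (C-diag n)) ⟩
    1# * n C suc a                            ≈⟨ *-identityˡ _ ⟩
    n C suc a                                 ≈⟨ *-identityʳ _ ⟨
    n C suc a * 1#                            ≈⟨ *-cong (C-congʳ (suc a) n+0≡n) (trans (C-congʳ (suc b) (ℕP.+-identityʳ (suc b))) (C-diag (suc b))) ⟨
    (n ℕ.+ 0) C suc a * (suc b ℕ.+ 0) C suc b ∎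
    where
    n = suc a ℕ.+ suc b
    n+0≡n = ℕP.+-identityʳ n
  C-revision (suc a) (suc b) (suc c) = begin
    (n C m + q^ suc m * n C suc m) * (m C a + q^ suc a * m C suc a)
      ≈⟨ expand _ _ _ _ ⟩
    n C m * m C a + (q^ suc a * m C suc a) * n C m + (q^ suc m * n C suc m) * suc m C suc a
      ≈⟨ +-cong (+-cong (C-revision a (suc b) (suc c)) (trans (*-assoc _ _ _) (*-congˡ (trans (*-comm _ _) shifted₁))))
                (trans (*-assoc _ _ _) (*-cong (q^-+ (suc a) (suc b)) shifted₂)) ⟩
    n C a * (suc b ℕ.+ suc c) C suc b + q^ suc a * (n C suc a * (b ℕ.+ suc c) C b)
      + (q^ suc a * q^ suc b) * (n C suc a * (b ℕ.+ suc c) C suc b)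
      ≈⟨ collect _ _ _ _ _ _ _ ⟩
    n C a * (suc b ℕ.+ suc c) C suc b + q^ suc a * n C suc a * ((b ℕ.+ suc c) C b + q^ suc b * (b ℕ.+ suc c) C suc b)
      ≈⟨ distribʳ _ _ _ ⟨
    (n C a + q^ suc a * n C suc a) * (suc b ℕ.+ suc c) C suc b
      ∎
    where
    n = a ℕ.+ suc b ℕ.+ suc c
    m = a ℕ.+ suc b
    m′ : suc (a ℕ.+ b) ≡ m
    m′ = P.sym (ℕP.+-suc a b)
    n′ : suc (a ℕ.+ b) ℕ.+ suc c ≡ n
    n′ = P.cong (ℕ._+ suc c) m′
    n″ : suc (a ℕ.+ suc b ℕ.+ c) ≡ n
    n″ = P.sym (ℕP.+-suc (a ℕ.+ suc b) c)
    shifted₁ : n C m * m C suc a ≈ n C suc a * (b ℕ.+ suc c) C b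
    shifted₁ = trans (sym (*-cong (C-cong n′ m′) (C-congʳ (suc a) m′)))
                     (trans (C-revision (suc a) b (suc c)) (*-congʳ (C-congʳ (suc a) n′)))
    shifted₂ : n C suc m * suc m C suc a ≈ n C suc a * (b ℕ.+ suc c) C suc b
    shifted₂ = trans (sym (*-congʳ (C-congʳ (suc m) n″)))
                     (trans (C-revision (suc a) (suc b) c)
                            (*-cong (C-congʳ (suc a) n″) (C-congʳ (suc b) (P.sym (ℕP.+-suc b c)))))
    expand : ∀ w x y z → (w + x) * (y + z) ≈ w * y + z * w + x * (y + z)
    expand = solve 4 (λ w x y z → (w :+ x) :* (y :+ z) := w :* y :+ z :* w :+ x :* (y :+ z)) refl
    collect : ∀ t u x y z v w → t * u + x * (z * v) + (x * y) * (z * w) ≈ t * u + x * z * (v + y * w)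
    collect = solve 7 (λ t u x y z v w → t :* u :+ x :* (z :* v) :+ (x :* y) :* (z :* w) := t :* u :+ x :* z :* (v :+ y :* w)) refl

  C-revision′ : ∀ a b c → (a ℕ.+ c) C a * c C b ≈ (a ℕ.+ b) C a * (a ℕ.+ c) C (a ℕ.+ b)
  C-revision′ a b c with b ℕP.≤? c
  ... | yes b≤c with ℕP.m≤n⇒∃[o]m+o≡n b≤c
  ...   | d , P.refl = begin
    (a ℕ.+ (b ℕ.+ d)) C a * (b ℕ.+ d) C b         ≈⟨ *-congʳ (C-congʳ a (P.sym (ℕP.+-assoc a b d))) ⟩
    (a ℕ.+ b ℕ.+ d) C a * (b ℕ.+ d) C b           ≈⟨ C-revision a b d ⟨
    (a ℕ.+ b ℕ.+ d) C (a ℕ.+ b) * (a ℕ.+ b) C a   ≈⟨ *-comm _ _ ⟩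
    (a ℕ.+ b) C a * (a ℕ.+ b ℕ.+ d) C (a ℕ.+ b)   ≈⟨ *-congˡ (C-congʳ (a ℕ.+ b) (ℕP.+-assoc a b d)) ⟩
    (a ℕ.+ b) C a * (a ℕ.+ (b ℕ.+ d)) C (a ℕ.+ b) ∎
  C-revision′ a b c | no b≰c = begin
    (a ℕ.+ c) C a * c C b                         ≈⟨ *-congˡ (C-above c<b) ⟩
    (a ℕ.+ c) C a * 0#                            ≈⟨ zeroʳ _ ⟩
    0#                                            ≈⟨ zeroʳ _ ⟨
    (a ℕ.+ b) C a * 0#                            ≈⟨ *-congˡ (C-above (ℕP.+-monoʳ-< a c<b)) ⟨
    (a ℕ.+ b) C a * (a ℕ.+ c) C (a ℕ.+ b)         ∎
    where c<b = ℕP.≰⇒> b≰c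

  C-dual-pascal-∸ : ∀ n k → suc n C suc k ≈ q^ (n ℕ.∸ k) * n C k + n C suc k
  C-dual-pascal-∸ n k with k ℕP.≤? n
  ... | yes k≤n with ℕP.m≤n⇒∃[o]m+o≡n k≤n
  ...   | o , P.refl = begin
    suc (k ℕ.+ o) C suc k                                   ≈⟨ C-congʳ (suc k) (P.cong suc k+o≡o+k) ⟩
    suc (o ℕ.+ k) C suc k                                   ≈⟨ C-dual-pascal o k ⟩
    q^ o * (o ℕ.+ k) C k + (o ℕ.+ k) C suc k                ≈⟨ +-cong (*-cong (q^-cong (ℕP.m+n∸m≡n k o)) (C-congʳ k k+o≡o+k))
                                                                     (C-congʳ (suc k) k+o≡o+k) ⟨
    q^ (k ℕ.+ o ℕ.∸ k) * (k ℕ.+ o) C k + (k ℕ.+ o) C suc k  ∎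
    where k+o≡o+k = ℕP.+-comm k o
  C-dual-pascal-∸ n k | no k≰n = begin
    suc n C suc k                              ≈⟨ C-above (s≤s n<k) ⟩
    0#                                         ≈⟨ +-identityʳ 0# ⟨
    0# + 0#                                    ≈⟨ +-cong (trans (*-congˡ (C-above n<k)) (zeroʳ _)) (C-above (ℕP.m<n⇒m<1+n n<k)) ⟨
    q^ (n ℕ.∸ k) * n C k + n C suc k           ∎
    where n<k = ℕP.≰⇒> k≰n

  -- The truncated subtraction a ∸ k is harmless: a C k = 0 for k > a.
  q-vandermonde : ∀ a c b → (a ℕ.+ c) C b ≈ conv b (λ k l → q^ ((a ℕ.∸ k) ℕ.* l) * (a C k * c C l))
  q-vandermonde zero c b = sym (begin
    conv b F                                          ≈⟨ ∑-first b _ ⟩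
    F 0 b + ∑ b (λ k → F (suc k) (b ℕ.∸ suc k))       ≈⟨ +-cong (trans (*-identityˡ _) (*-identityˡ _))
                                                                 (∑-≈0 b (λ k _ → trans (*-congˡ (zeroˡ _)) (zeroʳ _))) ⟩
    c C b + 0#                                        ≈⟨ +-identityʳ _ ⟩
    c C b                                             ∎)
    where
    F : ℕ → ℕ → Carrier
    F k l = q^ ((0 ℕ.∸ k) ℕ.* l) * (0 C k * c C l)
  q-vandermonde (suc a) c zero =
    sym (trans (+-identityʳ _) (trans (*-cong (q^-cong (ℕP.*-zeroʳ (suc a))) (*-identityˡ _)) (*-identityˡ _)))
  q-vandermonde (suc a) c (suc b) = begin
    (a ℕ.+ c) C b + q^ suc b * (a ℕ.+ c) C suc b
      ≈⟨ +-cong (q-vandermonde a c b) (*-congˡ (trans (q-vandermonde a c (suc b)) (conv-first b F))) ⟩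
    conv b F + q^ suc b * (F 0 (suc b) + conv b (λ k l → F (suc k) l))
      ≈⟨ +-congˡ (trans (distribˡ _ _ _) (+-congˡ (*-distribˡ-∑ (suc b) (q^ suc b) _))) ⟩
    conv b F + (q^ suc b * F 0 (suc b) + conv b (λ k l → q^ suc b * F (suc k) l))
      ≈⟨ +-congˡ (+-cong (sym F′₀) (sym (∑-cong< (suc b) (λ k k<1+b → shifted k (b ℕ.∸ k) (ℕP.m+[n∸m]≡n (ℕP.≤-pred k<1+b)))))) ⟩
    conv b F + (F′ 0 (suc b) + conv b Ψ)
      ≈⟨ +-CS.x∙yz≈y∙xz _ _ _ ⟩
    F′ 0 (suc b) + (conv b F + conv b Ψ)
      ≈⟨ +-congˡ (sym (trans (conv-cong b (λ k l → F′-suc k l)) (∑-distrib-+ (suc b) _ _))) ⟩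
    F′ 0 (suc b) + conv b (λ k l → F′ (suc k) l)
      ≈⟨ conv-first b F′ ⟨
    conv (suc b) F′
      ∎
    where
    F F′ Ψ : ℕ → ℕ → Carrier
    F k l = q^ ((a ℕ.∸ k) ℕ.* l) * (a C k * c C l)
    F′ k l = q^ ((suc a ℕ.∸ k) ℕ.* l) * (suc a C k * c C l)
    Ψ k l = q^ ((a ℕ.∸ k) ℕ.* l) * ((q^ suc k * a C suc k) * c C l)
    F′-suc : ∀ k l → F′ (suc k) l ≈ F k l + Ψ k l
    F′-suc k l = trans (*-congˡ (distribʳ _ _ _)) (distribˡ _ _ _)
    F′₀ : F′ 0 (suc b) ≈ q^ suc b * F 0 (suc b)
    F′₀ = trans (*-congʳ (q^-+ (suc b) (a ℕ.* suc b))) (*-assoc _ _ _)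
    exponent : ∀ k l → suc k ≤ a → (a ℕ.∸ k) ℕ.* l ℕ.+ suc k ≡ suc (k ℕ.+ l) ℕ.+ (a ℕ.∸ suc k) ℕ.* l
    exponent k l k<a with ℕP.m≤n⇒∃[o]m+o≡n k<a
    ... | r , P.refl = P.trans (P.cong (λ z → z ℕ.* l ℕ.+ suc k) a∸k≡1+r) (P.trans (rearrange r l k) (P.cong (λ z → suc (k ℕ.+ l) ℕ.+ z ℕ.* l) (P.sym (ℕP.m+n∸m≡n k r))))
      where
      a∸k≡1+r : suc k ℕ.+ r ℕ.∸ k ≡ suc r
      a∸k≡1+r = P.trans (P.cong (ℕ._∸ k) (P.sym (ℕP.+-suc k r))) (ℕP.m+n∸m≡n k (suc r))
      rearrange : ∀ r l k → suc r ℕ.* l ℕ.+ suc k ≡ suc (k ℕ.+ l) ℕ.+ r ℕ.* l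
      rearrange = solve-∀
    shifted : ∀ k l → k ℕ.+ l ≡ b → Ψ k l ≈ q^ suc b * F (suc k) l
    shifted k l k+l≡b with suc k ℕP.≤? a
    ... | yes k<a = begin
      q^ ((a ℕ.∸ k) ℕ.* l) * ((q^ suc k * a C suc k) * c C l)   ≈⟨ trans (*-congˡ (*-assoc _ _ _)) (sym (*-assoc _ _ _)) ⟩
      (q^ ((a ℕ.∸ k) ℕ.* l) * q^ suc k) * (a C suc k * c C l)   ≈⟨ *-congʳ (trans (sym (q^-+ ((a ℕ.∸ k) ℕ.* l) (suc k)))
                                                                      (trans (q^-cong (P.trans (exponent k l k<a) (P.cong (λ z → suc z ℕ.+ (a ℕ.∸ suc k) ℕ.* l) k+l≡b)))
                                                                             (q^-+ (suc b) _))) ⟩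
      (q^ suc b * q^ ((a ℕ.∸ suc k) ℕ.* l)) * (a C suc k * c C l) ≈⟨ *-assoc _ _ _ ⟩
      q^ suc b * F (suc k) l                                    ∎
    ... | no k≮a = trans (*-congˡ (trans (*-congʳ (trans (*-congˡ a<k+1) (zeroʳ _))) (zeroˡ (c C l))))
                   (trans (zeroʳ _) (sym (trans (*-congˡ (trans (*-congˡ (trans (*-congʳ a<k+1) (zeroˡ (c C l)))) (zeroʳ _))) (zeroʳ _))))
      where
      a<k+1 : a C suc k ≈ 0#
      a<k+1 = C-above (ℕP.≰⇒> k≮a)

module AlternatingSums {r₁ r₂ : Level} (R : CommutativeRing r₁ r₂) (q : CommutativeRing.Carrier R) where
  open CommutativeRing R hiding (zero)
  open Sums R
  open QBinomials R q
  open Arithmetic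
  open import Algebra.Properties.Ring ring using (-‿distribˡ-*; -‿distribʳ-*; -‿involutive)
  open import Relation.Binary.Reasoning.Setoid setoid
  open import Algebra.Solver.Ring.NaturalCoefficients.Default commutativeSemiring
    using (solve; _:=_; _:*_)

  sign : ℕ → Carrier
  sign zero = 1#
  sign (suc n) = - sign n

  altSum : ℕ → ℕ → Carrier
  altSum n c = ∑ (suc n) (λ i → sign i * (q^ tri⊖ i c * n C i))


  altSum-suc : ∀ n c → c ≤ suc n → altSum (suc n) c ≈ altSum n c - q^ (suc n ℕ.∸ c) * altSum n c
  altSum-suc n c c≤1+n = begin
    altSum (suc n) c
      ≈⟨ ∑-first (suc n) _ ⟩
    t 0 + ∑ (suc n) (λ i → sign (suc i) * (q^ tri⊖ (suc i) c * suc n C suc i))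
      ≈⟨ +-congˡ (trans (∑-cong (suc n) pascal-split) (∑-distrib-+ (suc n) _ _)) ⟩
    t 0 + (∑ (suc n) (λ i → t (suc i)) + ∑ (suc n) u)
      ≈⟨ +-assoc _ _ _ ⟨
    (t 0 + ∑ (suc n) (λ i → t (suc i))) + ∑ (suc n) u
      ≈⟨ +-cong (sym (∑-first (suc n) t)) (∑-cong< (suc n) (λ i i<1+n → u≈ i (ℕP.≤-pred i<1+n))) ⟩
    ∑ (suc (suc n)) t + ∑ (suc n) (λ i → - (q^ (suc n ℕ.∸ c) * t i))
      ≈⟨ +-cong (trans (+-congʳ t-top) (+-identityˡ _)) (sym (-‿distrib-∑ (suc n) _)) ⟩
    altSum n c + - ∑ (suc n) (λ i → q^ (suc n ℕ.∸ c) * t i)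
      ≈⟨ +-congˡ (-‿cong (*-distribˡ-∑ (suc n) _ t)) ⟨
    altSum n c - q^ (suc n ℕ.∸ c) * altSum n c
      ∎
    where
    t u : ℕ → Carrier
    t i = sign i * (q^ tri⊖ i c * n C i)
    u i = sign (suc i) * (q^ tri⊖ (suc i) c * (q^ (n ℕ.∸ i) * n C i))
    pascal-split : ∀ i → sign (suc i) * (q^ tri⊖ (suc i) c * suc n C suc i) ≈ t (suc i) + u i
    pascal-split i = trans (*-congˡ (trans (*-congˡ (trans (C-dual-pascal-∸ n i) (+-comm _ _))) (distribˡ _ _ _))) (distribˡ _ _ _)
    t-top : t (suc n) ≈ 0#
    t-top = trans (*-congˡ (trans (*-congˡ (C-above (ℕP.n<1+n n))) (zeroʳ _))) (zeroʳ _)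
    u≈ : ∀ i → i ≤ n → u i ≈ - (q^ (suc n ℕ.∸ c) * t i)
    u≈ i i≤n = begin
      - sign i * (q^ tri⊖ (suc i) c * (q^ (n ℕ.∸ i) * n C i))      ≈⟨ -‿distribˡ-* _ _ ⟨
      - (sign i * (q^ tri⊖ (suc i) c * (q^ (n ℕ.∸ i) * n C i)))    ≈⟨ -‿cong (*-congˡ (*-assoc _ _ _)) ⟨
      - (sign i * ((q^ tri⊖ (suc i) c * q^ (n ℕ.∸ i)) * n C i))    ≈⟨ -‿cong (*-congˡ (*-congʳ exponent)) ⟩
      - (sign i * ((q^ tri⊖ i c * q^ (suc n ℕ.∸ c)) * n C i))      ≈⟨ -‿cong (rearrange _ _ _ _) ⟩
      - (q^ (suc n ℕ.∸ c) * t i)                                  ∎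
      where
      exponent : q^ tri⊖ (suc i) c * q^ (n ℕ.∸ i) ≈ q^ tri⊖ i c * q^ (suc n ℕ.∸ c)
      exponent = trans (sym (q^-+ (tri⊖ (suc i) c) (n ℕ.∸ i))) (trans (q^-cong (tri⊖-shift i c n i≤n c≤1+n)) (q^-+ (tri⊖ i c) (suc n ℕ.∸ c)))
      rearrange : ∀ s x y z → s * ((x * y) * z) ≈ y * (s * (x * z))
      rearrange = solve 4 (λ s x y z → s :* ((x :* y) :* z) := y :* (s :* (x :* z))) refl

  altSum-vanish : ∀ c d → altSum (d ℕ.+ suc c) (suc c) ≈ 0#
  altSum-vanish c zero = begin
    altSum (suc c) (suc c)                                  ≈⟨ altSum-suc c (suc c) ℕP.≤-refl ⟩
    altSum c (suc c) - q^ (c ℕ.∸ c) * altSum c (suc c)      ≈⟨ +-congˡ (-‿cong (trans (*-congʳ (q^-cong (ℕP.n∸n≡0 c))) (*-identityˡ _))) ⟩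
    altSum c (suc c) - altSum c (suc c)                     ≈⟨ -‿inverseʳ _ ⟩
    0#                                                      ∎
  altSum-vanish c (suc d) = begin
    altSum (suc (d ℕ.+ suc c)) (suc c)
      ≈⟨ altSum-suc (d ℕ.+ suc c) (suc c) (ℕP.m≤n⇒m≤1+n (ℕP.m≤n+m (suc c) d)) ⟩
    altSum (d ℕ.+ suc c) (suc c) - q^ (d ℕ.+ suc c ℕ.∸ c) * altSum (d ℕ.+ suc c) (suc c)
      ≈⟨ +-cong (altSum-vanish c d) (-‿cong (trans (*-congˡ (altSum-vanish c d)) (zeroʳ _))) ⟩
    0# - 0#
      ≈⟨ -‿inverseʳ 0# ⟩
    0#
      ∎

  sign-+ : ∀ a b → sign (a ℕ.+ b) ≈ sign a * sign b
  sign-+ zero b = sym (*-identityˡ _)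
  sign-+ (suc a) b = trans (-‿cong (sign-+ a b)) (-‿distribˡ-* _ _)

  sign-square : ∀ a → sign a * sign a ≈ 1#
  sign-square zero = *-identityˡ 1#
  sign-square (suc a) = begin
    - sign a * - sign a       ≈⟨ -‿distribʳ-* _ _ ⟨
    - (- sign a * sign a)     ≈⟨ -‿cong (-‿distribˡ-* _ _) ⟨
    - - (sign a * sign a)     ≈⟨ -‿involutive _ ⟩
    sign a * sign a           ≈⟨ sign-square a ⟩
    1#                        ∎

  -- Σ_{|j| ≤ m} (-1)^j q^(j(j+1)/2) [2m, m+j], the terms with j < 0 written as [2m, m-j].
  centralAltSum : ℕ → Carrier
  centralAltSum m = ∑ (suc m) (λ p → sign p * (q^ tri p * (m ℕ.+ m) C (m ℕ.+ p)))
                  + ∑ m (λ p → sign (suc p) * (q^ tri p * (m ℕ.+ m) C (m ℕ.+ suc p)))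

  altSum-central : ∀ m → altSum (m ℕ.+ m) m ≈ sign m * centralAltSum m
  altSum-central m = begin
    ∑ (suc (m ℕ.+ m)) t
      ≡⟨ P.cong (λ z → ∑ z t) (P.sym (ℕP.+-suc m m)) ⟩
    ∑ (m ℕ.+ suc m) t
      ≈⟨ ∑-split m (suc m) t ⟩
    ∑ m t + ∑ (suc m) (λ p → t (m ℕ.+ p))
      ≈⟨ +-cong (trans (∑-reverse m t) (∑-cong< m below)) (∑-cong (suc m) above) ⟩
    ∑ m (λ p → sign m * t⁻ p) + ∑ (suc m) (λ p → sign m * t⁺ p)
      ≈⟨ +-comm _ _ ⟩
    ∑ (suc m) (λ p → sign m * t⁺ p) + ∑ m (λ p → sign m * t⁻ p)
      ≈⟨ +-cong (*-distribˡ-∑ (suc m) (sign m) t⁺) (*-distribˡ-∑ m (sign m) t⁻) ⟨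
    sign m * ∑ (suc m) t⁺ + sign m * ∑ m t⁻
      ≈⟨ distribˡ _ _ _ ⟨
    sign m * centralAltSum m
      ∎
    where
    t t⁺ t⁻ : ℕ → Carrier
    t i = sign i * (q^ tri⊖ i m * (m ℕ.+ m) C i)
    t⁺ p = sign p * (q^ tri p * (m ℕ.+ m) C (m ℕ.+ p))
    t⁻ p = sign (suc p) * (q^ tri p * (m ℕ.+ m) C (m ℕ.+ suc p))
    above : ∀ p → t (m ℕ.+ p) ≈ sign m * t⁺ p
    above p = trans (*-cong (sign-+ m p) (*-congʳ (q^-cong (tri⊖-≥ m p)))) (*-assoc _ _ _)
    below : ∀ p → p < m → t (m ℕ.∸ suc p) ≈ sign m * t⁻ p
    below p p<m = begin
      sign i * (q^ tri⊖ i m * (m ℕ.+ m) C i)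
        ≈⟨ *-cong sign-i (*-cong (q^-cong (P.trans (P.cong (tri⊖ i) (P.sym i+1+p≡m)) (tri⊖-< i p))) binomial-i) ⟩
      (sign m * sign (suc p)) * (q^ tri p * (m ℕ.+ m) C (m ℕ.+ suc p))
        ≈⟨ *-assoc _ _ _ ⟩
      sign m * t⁻ p
        ∎
      where
      i = m ℕ.∸ suc p
      i+1+p≡m : i ℕ.+ suc p ≡ m
      i+1+p≡m = ℕP.m∸n+n≡m p<m
      i+m+1+p≡m+m : i ℕ.+ (m ℕ.+ suc p) ≡ m ℕ.+ m
      i+m+1+p≡m+m = P.trans (P.cong (i ℕ.+_) (ℕP.+-comm m (suc p)))
                      (P.trans (P.sym (ℕP.+-assoc i (suc p) m)) (P.cong (ℕ._+ m) i+1+p≡m))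
      binomial-i : (m ℕ.+ m) C i ≈ (m ℕ.+ m) C (m ℕ.+ suc p)
      binomial-i = trans (C-congʳ i (P.sym i+m+1+p≡m+m))
                     (trans (C-sym i (m ℕ.+ suc p)) (C-congʳ (m ℕ.+ suc p) i+m+1+p≡m+m))
      sign-i : sign i ≈ sign m * sign (suc p)
      sign-i = begin
        sign i                                     ≈⟨ *-identityʳ _ ⟨
        sign i * 1#                                ≈⟨ *-congˡ (sign-square (suc p)) ⟨
        sign i * (sign (suc p) * sign (suc p))     ≈⟨ *-assoc _ _ _ ⟨
        (sign i * sign (suc p)) * sign (suc p)     ≈⟨ *-congʳ (trans (sym (sign-+ i (suc p))) (reflexive (P.cong sign i+1+p≡m))) ⟩
        sign m * sign (suc p)                      ∎

  centralAltSum-zero : centralAltSum 0 ≈ 1#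
  centralAltSum-zero = trans (+-identityʳ _) (trans (+-identityʳ _) (trans (*-identityˡ _) (*-identityˡ _)))

  centralAltSum-suc : ∀ m → centralAltSum (suc m) ≈ 0#
  centralAltSum-suc m = begin
    centralAltSum (suc m)                                ≈⟨ *-identityˡ _ ⟨
    1# * centralAltSum (suc m)                           ≈⟨ *-congʳ (sign-square (suc m)) ⟨
    (sign (suc m) * sign (suc m)) * centralAltSum (suc m) ≈⟨ *-assoc _ _ _ ⟩
    sign (suc m) * (sign (suc m) * centralAltSum (suc m)) ≈⟨ *-congˡ (altSum-central (suc m)) ⟨
    sign (suc m) * altSum (suc m ℕ.+ suc m) (suc m)      ≈⟨ *-congˡ (altSum-vanish m (suc m)) ⟩
    sign (suc m) * 0#                                    ≈⟨ zeroʳ _ ⟩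
    0#                                                   ∎

module PentagonalIdentity {r₁ r₂ : Level} (R : CommutativeRing r₁ r₂) (q : CommutativeRing.Carrier R) where
  open CommutativeRing R hiding (zero)
  open Sums R
  open QBinomials R q
  open Arithmetic
  open AlternatingSums R q
  open import Algebra.Properties.Ring ring using (-‿distribˡ-*)
  open import Relation.Binary.Reasoning.Setoid setoid
  open import Algebra.Solver.Ring.NaturalCoefficients.Default commutativeSemiring
    using (solve; _:=_; _:*_)

  -- L C[ n ⊖ p ] is [L, n - p] for the integer n - p.
  _C[_⊖_] : ℕ → ℕ → ℕ → Carrier
  L C[ n ⊖ zero ] = L C n
  L C[ zero ⊖ suc p ] = 0#
  L C[ suc n ⊖ suc p ] = L C[ n ⊖ p ]

  C⊖-≥ : ∀ L p k → L C[ p ℕ.+ k ⊖ p ] ≈ L C k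
  C⊖-≥ L zero k = refl
  C⊖-≥ L (suc p) k = C⊖-≥ L p k

  C⊖-< : ∀ L n p → n < p → L C[ n ⊖ p ] ≈ 0#
  C⊖-< L zero (suc p) _ = refl
  C⊖-< L (suc n) (suc p) (s≤s n<p) = C⊖-< L n p n<p

  C⊖-pascal : ∀ L n p → suc L C[ n ⊖ p ] ≈ L C[ n ⊖ suc p ] + q^ (n ℕ.∸ p) * L C[ n ⊖ p ]
  C⊖-pascal L zero zero = sym (trans (+-identityˡ _) (*-identityˡ _))
  C⊖-pascal L (suc n) zero = refl
  C⊖-pascal L zero (suc p) = sym (trans (+-identityˡ _) (zeroʳ _))
  C⊖-pascal L (suc n) (suc p) = C⊖-pascal L n p

  coeff : ℕ → ℕ → ℕ → Carrier
  coeff L k m = L C (m ℕ.+ m ℕ.+ k) * (m ℕ.+ m ℕ.+ k) C k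

  expansionTerm : ℕ → ℕ → ℕ → ℕ → Carrier
  expansionTerm L p k m = q^ ((m ℕ.+ p) ℕ.* (m ℕ.∸ p)) * (coeff L k m * (m ℕ.+ m) C (m ℕ.+ p))

  expansionTerm-< : ∀ L p k m → m < p → expansionTerm L p k m ≈ 0#
  expansionTerm-< L p k m m<p =
    trans (*-congˡ (trans (*-congˡ (C-above (ℕP.+-monoʳ-< m m<p))) (zeroʳ _))) (zeroʳ _)

  vandermondeTerm≈expansionTerm : ∀ p r k c → k ≤ r →
    (p ℕ.+ r ℕ.+ p ℕ.+ c) C (p ℕ.+ r ℕ.+ p)
      * (q^ ((p ℕ.+ r ℕ.+ p ℕ.∸ k) ℕ.* (r ℕ.∸ k)) * ((p ℕ.+ r ℕ.+ p) C k * c C (r ℕ.∸ k)))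
    ≈ expansionTerm (p ℕ.+ r ℕ.+ p ℕ.+ c) p k (p ℕ.+ (r ℕ.∸ k))
  vandermondeTerm≈expansionTerm p r k c k≤r with ℕP.m≤n⇒∃[o]m+o≡n k≤r
  ... | l , P.refl rewrite ℕP.m+n∸m≡n k l = begin
    L C n₂ * (E * (n₂ C k * c C l))
      ≈⟨ rearrange₁ _ _ _ _ ⟩
    E * (((n₂ ℕ.+ c) C n₂ * c C l) * n₂ C k)
      ≈⟨ *-congˡ (*-congʳ (C-revision′ n₂ l c)) ⟩
    E * (((n₂ ℕ.+ l) C n₂ * (n₂ ℕ.+ c) C (n₂ ℕ.+ l)) * n₂ C k)
      ≈⟨ rearrange₂ _ _ _ _ ⟩
    E * (L C (n₂ ℕ.+ l) * ((n₂ ℕ.+ l) C n₂ * n₂ C k))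
      ≈⟨ *-congˡ (*-cong (C-congˡ L (e₂ p k l))
                         (sym (*-cong (C-cong (P.cong (ℕ._+ l) (e₃ p k l)) (e₃ p k l)) (C-congʳ k (e₃ p k l))))) ⟩
    E * (L C (m ℕ.+ m ℕ.+ k) * ((k ℕ.+ (m ℕ.+ p) ℕ.+ l) C (k ℕ.+ (m ℕ.+ p)) * (k ℕ.+ (m ℕ.+ p)) C k))
      ≈⟨ *-congˡ (*-congˡ (C-revision k (m ℕ.+ p) l)) ⟩
    E * (L C (m ℕ.+ m ℕ.+ k) * ((k ℕ.+ (m ℕ.+ p) ℕ.+ l) C k * (m ℕ.+ p ℕ.+ l) C (m ℕ.+ p)))
      ≈⟨ *-congˡ (*-congˡ (*-cong (C-congʳ k (e₄ p k l)) (C-congʳ (m ℕ.+ p) (e₅ p l)))) ⟩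
    E * (L C (m ℕ.+ m ℕ.+ k) * ((m ℕ.+ m ℕ.+ k) C k * (m ℕ.+ m) C (m ℕ.+ p)))
      ≈⟨ *-congˡ (*-assoc _ _ _) ⟨
    E * (coeff L k m * (m ℕ.+ m) C (m ℕ.+ p))
      ≈⟨ *-congʳ (q^-cong (P.cong₂ ℕ._*_ (e₁ p k l) (P.sym (ℕP.m+n∸m≡n p l)))) ⟩
    expansionTerm L p k m
      ∎
    where
    n₂ = p ℕ.+ (k ℕ.+ l) ℕ.+ p
    L = n₂ ℕ.+ c
    m = p ℕ.+ l
    E = q^ ((n₂ ℕ.∸ k) ℕ.* l)
    e₁ : ∀ p k l → p ℕ.+ (k ℕ.+ l) ℕ.+ p ℕ.∸ k ≡ p ℕ.+ l ℕ.+ p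
    e₁ p k l = P.trans (P.cong (ℕ._∸ k) (e p k l)) (ℕP.m+n∸m≡n k (p ℕ.+ l ℕ.+ p))
      where
      e : ∀ p k l → p ℕ.+ (k ℕ.+ l) ℕ.+ p ≡ k ℕ.+ (p ℕ.+ l ℕ.+ p)
      e = solve-∀
    e₂ : ∀ p k l → p ℕ.+ (k ℕ.+ l) ℕ.+ p ℕ.+ l ≡ p ℕ.+ l ℕ.+ (p ℕ.+ l) ℕ.+ k
    e₂ = solve-∀
    e₃ : ∀ p k l → k ℕ.+ (p ℕ.+ l ℕ.+ p) ≡ p ℕ.+ (k ℕ.+ l) ℕ.+ p
    e₃ = solve-∀
    e₄ : ∀ p k l → k ℕ.+ (p ℕ.+ l ℕ.+ p) ℕ.+ l ≡ p ℕ.+ l ℕ.+ (p ℕ.+ l) ℕ.+ k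
    e₄ = solve-∀
    e₅ : ∀ p l → p ℕ.+ l ℕ.+ p ℕ.+ l ≡ p ℕ.+ l ℕ.+ (p ℕ.+ l)
    e₅ = solve-∀
    rearrange₁ : ∀ a e b x → a * (e * (b * x)) ≈ e * ((a * x) * b)
    rearrange₁ = solve 4 (λ a e b x → a :* (e :* (b :* x)) := e :* ((a :* x) :* b)) refl
    rearrange₂ : ∀ e u v b → e * ((u * v) * b) ≈ e * (v * (u * b))
    rearrange₂ = solve 4 (λ e u v b → e :* ((u :* v) :* b) := e :* (v :* (u :* b))) refl

  C-product-expansion : ∀ L n p → L C (n ℕ.+ p) * L C[ n ⊖ p ] ≈ conv n (expansionTerm L p)
  C-product-expansion L n p with p ℕP.≤? n
  ... | no p≰n = begin
    L C (n ℕ.+ p) * L C[ n ⊖ p ]     ≈⟨ *-congˡ (C⊖-< L n p n<p) ⟩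
    L C (n ℕ.+ p) * 0#               ≈⟨ zeroʳ _ ⟩
    0#                               ≈⟨ ∑-≈0 (suc n) (λ k _ → expansionTerm-< L p k (n ℕ.∸ k) (ℕP.≤-<-trans (ℕP.m∸n≤m n k) n<p)) ⟨
    conv n (expansionTerm L p)       ∎
    where n<p = ℕP.≰⇒> p≰n
  ... | yes p≤n with ℕP.m≤n⇒∃[o]m+o≡n p≤n
  ...   | r , P.refl with p ℕ.+ r ℕ.+ p ℕP.≤? L
  ...     | no n₂≰L = begin
    L C (p ℕ.+ r ℕ.+ p) * L C[ p ℕ.+ r ⊖ p ]     ≈⟨ *-congʳ (C-above L<n₂) ⟩
    0# * L C[ p ℕ.+ r ⊖ p ]                      ≈⟨ zeroˡ _ ⟩
    0#                                           ≈⟨ ∑-≈0 (suc (p ℕ.+ r)) (λ k k<1+n → term≈0 k (ℕP.≤-pred k<1+n)) ⟨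
    conv (p ℕ.+ r) (expansionTerm L p)           ∎
    where
    L<n₂ = ℕP.≰⇒> n₂≰L
    term≈0 : ∀ k → k ≤ p ℕ.+ r → expansionTerm L p k (p ℕ.+ r ℕ.∸ k) ≈ 0#
    term≈0 k k≤n with p ℕP.≤? (p ℕ.+ r ℕ.∸ k)
    ... | no p≰m = expansionTerm-< L p k _ (ℕP.≰⇒> p≰m)
    ... | yes p≤m = trans (*-congˡ (trans (*-congʳ (trans (*-congʳ (C-above (ℕP.<-≤-trans L<n₂ (n+p≤2[n∸k]+k k≤n p≤m)))) (zeroˡ _))) (zeroˡ _))) (zeroʳ _)
  ...     | yes n₂≤L with ℕP.m≤n⇒∃[o]m+o≡n n₂≤L
  ...       | c , P.refl = begin
    L C n₂ * L C[ p ℕ.+ r ⊖ p ]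
      ≈⟨ *-congˡ (C⊖-≥ L p r) ⟩
    L C n₂ * (n₂ ℕ.+ c) C r
      ≈⟨ *-congˡ (q-vandermonde n₂ c r) ⟩
    L C n₂ * conv r (λ k l → q^ ((n₂ ℕ.∸ k) ℕ.* l) * (n₂ C k * c C l))
      ≈⟨ *-distribˡ-∑ (suc r) _ _ ⟩
    ∑ (suc r) (λ k → L C n₂ * (q^ ((n₂ ℕ.∸ k) ℕ.* (r ℕ.∸ k)) * (n₂ C k * c C (r ℕ.∸ k))))
      ≈⟨ ∑-cong< (suc r) (λ k k<1+r → trans (vandermondeTerm≈expansionTerm p r k c (ℕP.≤-pred k<1+r))
                                            (reflexive (P.cong (expansionTerm L p k) (P.sym (ℕP.+-∸-assoc p (ℕP.≤-pred k<1+r)))))) ⟩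
    ∑ (suc r) (λ k → expansionTerm L p k (p ℕ.+ r ℕ.∸ k))
      ≈⟨ ∑-trim _ (s≤s (ℕP.m≤n+m r p)) (λ i r<i i≤n → expansionTerm-< L p i _ (m<p i r<i (ℕP.≤-pred i≤n))) ⟨
    conv (p ℕ.+ r) (expansionTerm L p)
      ∎
    where
    n₂ = p ℕ.+ r ℕ.+ p
    m<p : ∀ i → r < i → i ≤ p ℕ.+ r → p ℕ.+ r ℕ.∸ i < p
    m<p i r<i i≤n = P.subst (p ℕ.+ r ℕ.∸ i <_) (ℕP.m+n∸n≡m p r) (ℕP.∸-monoʳ-< r<i i≤n)

  -- The factor q^(p*p) of the weight cancels the p-dependence of the exponent (m+p)(m-p).
  weighted-expansionTerm : ∀ s p t L k m → (s * q^ (p ℕ.* p ℕ.+ t)) * expansionTerm L p k m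
                           ≈ coeff L k m * (q^ (m ℕ.* m) * (s * (q^ t * (m ℕ.+ m) C (m ℕ.+ p))))
  weighted-expansionTerm s p t L k m with p ℕP.≤? m
  ... | yes p≤m = begin
    (s * q^ (p ℕ.* p ℕ.+ t)) * (q^ ((m ℕ.+ p) ℕ.* (m ℕ.∸ p)) * (coeff L k m * (m ℕ.+ m) C (m ℕ.+ p)))
      ≈⟨ rearrange₁ _ _ _ _ _ ⟩
    coeff L k m * (s * ((q^ (p ℕ.* p ℕ.+ t) * q^ ((m ℕ.+ p) ℕ.* (m ℕ.∸ p))) * (m ℕ.+ m) C (m ℕ.+ p)))
      ≈⟨ *-congˡ (*-congˡ (*-congʳ exponent)) ⟩
    coeff L k m * (s * ((q^ (m ℕ.* m) * q^ t) * (m ℕ.+ m) C (m ℕ.+ p)))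
      ≈⟨ rearrange₂ _ _ _ _ _ ⟩
    coeff L k m * (q^ (m ℕ.* m) * (s * (q^ t * (m ℕ.+ m) C (m ℕ.+ p))))
      ∎
    where
    exponent : q^ (p ℕ.* p ℕ.+ t) * q^ ((m ℕ.+ p) ℕ.* (m ℕ.∸ p)) ≈ q^ (m ℕ.* m) * q^ t
    exponent = begin
      q^ (p ℕ.* p ℕ.+ t) * q^ ((m ℕ.+ p) ℕ.* (m ℕ.∸ p))   ≈⟨ q^-+ (p ℕ.* p ℕ.+ t) _ ⟨
      q^ (p ℕ.* p ℕ.+ t ℕ.+ (m ℕ.+ p) ℕ.* (m ℕ.∸ p))      ≡⟨ P.cong q^_ (swap (p ℕ.* p) t _) ⟩
      q^ (p ℕ.* p ℕ.+ (m ℕ.+ p) ℕ.* (m ℕ.∸ p) ℕ.+ t)      ≡⟨ P.cong (λ e → q^ (e ℕ.+ t)) (p*p+[m+p]*[m∸p]≡m*m p≤m) ⟩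
      q^ (m ℕ.* m ℕ.+ t)                                  ≈⟨ q^-+ (m ℕ.* m) t ⟩
      q^ (m ℕ.* m) * q^ t                                 ∎
      where
      swap : ∀ x y z → x ℕ.+ y ℕ.+ z ≡ x ℕ.+ z ℕ.+ y
      swap = solve-∀
    rearrange₁ : ∀ s a b c g → (s * a) * (b * (c * g)) ≈ c * (s * ((a * b) * g))
    rearrange₁ = solve 5 (λ s a b c g → (s :* a) :* (b :* (c :* g)) := c :* (s :* ((a :* b) :* g))) refl
    rearrange₂ : ∀ s m t c g → c * (s * ((m * t) * g)) ≈ c * (m * (s * (t * g)))
    rearrange₂ = solve 5 (λ s m t c g → c :* (s :* ((m :* t) :* g)) := c :* (m :* (s :* (t :* g)))) refl
  ... | no p≰m = trans (*-congˡ (expansionTerm-< L p k m m<p))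
                  (trans (zeroʳ _) (sym (trans (*-congˡ (trans (*-congˡ (trans (*-congˡ (trans (*-congˡ binomial≈0) (zeroʳ _))) (zeroʳ _))) (zeroʳ _))) (zeroʳ _))))
    where
    m<p = ℕP.≰⇒> p≰m
    binomial≈0 : (m ℕ.+ m) C (m ℕ.+ p) ≈ 0#
    binomial≈0 = C-above (ℕP.+-monoʳ-< m m<p)

  -- The pentagonal weight (-1)^j q^(j(3j+1)/2) at j = p and at j = -(p+1).
  w⁺ w⁻ : ℕ → Carrier
  w⁺ p = sign p * q^ (p ℕ.* p ℕ.+ tri p)
  w⁻ p = sign (suc p) * q^ (suc p ℕ.* suc p ℕ.+ tri p)

  pentagonal-identity : ∀ L n →
    ∑ (suc n) (λ p → w⁺ p * (L C (n ℕ.+ p) * L C[ n ⊖ p ]))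
      + ∑ (suc n) (λ p → w⁻ p * (L C (n ℕ.+ suc p) * L C[ n ⊖ suc p ]))
    ≈ L C n
  pentagonal-identity L n = begin
    ∑ (suc n) (λ p → w⁺ p * (L C (n ℕ.+ p) * L C[ n ⊖ p ]))
      + ∑ (suc n) (λ p → w⁻ p * (L C (n ℕ.+ suc p) * L C[ n ⊖ suc p ]))
      ≈⟨ +-cong (∑-cong (suc n) (λ p → trans (*-congˡ (C-product-expansion L n p)) (*-distribˡ-∑ (suc n) (w⁺ p) _)))
                (∑-cong (suc n) (λ p → trans (*-congˡ (C-product-expansion L n (suc p))) (*-distribˡ-∑ (suc n) (w⁻ p) _))) ⟩
    ∑ (suc n) (λ p → ∑ (suc n) (λ k → w⁺ p * expansionTerm L p k (n ℕ.∸ k)))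
      + ∑ (suc n) (λ p → ∑ (suc n) (λ k → w⁻ p * expansionTerm L (suc p) k (n ℕ.∸ k)))
      ≈⟨ +-cong (∑-comm (suc n) (suc n) _) (∑-comm (suc n) (suc n) _) ⟩
    ∑ (suc n) (λ k → ∑ (suc n) (λ p → w⁺ p * expansionTerm L p k (n ℕ.∸ k)))
      + ∑ (suc n) (λ k → ∑ (suc n) (λ p → w⁻ p * expansionTerm L (suc p) k (n ℕ.∸ k)))
      ≈⟨ ∑-distrib-+ (suc n) _ _ ⟨
    ∑ (suc n) (λ k → ∑ (suc n) (λ p → w⁺ p * expansionTerm L p k (n ℕ.∸ k))
                   + ∑ (suc n) (λ p → w⁻ p * expansionTerm L (suc p) k (n ℕ.∸ k)))
      ≈⟨ ∑-cong (suc n) (λ k → inner k (n ℕ.∸ k) (ℕP.m∸n≤m n k)) ⟩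
    ∑ (suc n) (λ k → coeff L k (n ℕ.∸ k) * (q^ ((n ℕ.∸ k) ℕ.* (n ℕ.∸ k)) * centralAltSum (n ℕ.∸ k)))
      ≈⟨ ∑-single (suc n) n ℕP.≤-refl (λ k k<1+n k≢n → off-diagonal k (ℕP.≤∧≢⇒< (ℕP.≤-pred k<1+n) k≢n)) ⟩
    coeff L n (n ℕ.∸ n) * (q^ ((n ℕ.∸ n) ℕ.* (n ℕ.∸ n)) * centralAltSum (n ℕ.∸ n))
      ≡⟨ P.cong (λ z → coeff L n z * (q^ (z ℕ.* z) * centralAltSum z)) (ℕP.n∸n≡0 n) ⟩
    coeff L n 0 * (1# * centralAltSum 0)
      ≈⟨ *-cong (*-congˡ (C-diag n)) (trans (*-identityˡ _) centralAltSum-zero) ⟩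
    (L C n * 1#) * 1#
      ≈⟨ trans (*-identityʳ _) (*-identityʳ _) ⟩
    L C n
      ∎
    where
    off-diagonal : ∀ k → k < n → coeff L k (n ℕ.∸ k) * (q^ ((n ℕ.∸ k) ℕ.* (n ℕ.∸ k)) * centralAltSum (n ℕ.∸ k)) ≈ 0#
    off-diagonal k k<n = trans (*-congˡ (trans (*-congˡ vanishes) (zeroʳ _))) (zeroʳ _)
      where
      vanishes : centralAltSum (n ℕ.∸ k) ≈ 0#
      vanishes = trans (reflexive (P.cong centralAltSum (ℕP.+-∸-assoc 1 k<n))) (centralAltSum-suc (n ℕ.∸ suc k))
    inner : ∀ k m → m ≤ n →
      ∑ (suc n) (λ p → w⁺ p * expansionTerm L p k m) + ∑ (suc n) (λ p → w⁻ p * expansionTerm L (suc p) k m)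
      ≈ coeff L k m * (q^ (m ℕ.* m) * centralAltSum m)
    inner k m m≤n = begin
      ∑ (suc n) (λ p → w⁺ p * expansionTerm L p k m) + ∑ (suc n) (λ p → w⁻ p * expansionTerm L (suc p) k m)
        ≈⟨ +-cong (∑-cong (suc n) (λ p → weighted-expansionTerm (sign p) p (tri p) L k m))
                  (∑-cong (suc n) (λ p → weighted-expansionTerm (sign (suc p)) (suc p) (tri p) L k m)) ⟩
      ∑ (suc n) (λ p → c * (Q * t⁺ p)) + ∑ (suc n) (λ p → c * (Q * t⁻ p))
        ≈⟨ +-cong (factor t⁺) (factor t⁻) ⟩
      c * (Q * ∑ (suc n) t⁺) + c * (Q * ∑ (suc n) t⁻)
        ≈⟨ trans (sym (distribˡ _ _ _)) (*-congˡ (sym (distribˡ _ _ _))) ⟩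
      c * (Q * (∑ (suc n) t⁺ + ∑ (suc n) t⁻))
        ≈⟨ *-congˡ (*-congˡ (+-cong (∑-trim t⁺ (s≤s m≤n) (λ i m<i _ → t≈0 {t = tri i} (ℕP.+-monoʳ-< m m<i)))
                                   (∑-trim t⁻ (ℕP.m≤n⇒m≤1+n m≤n) (λ i m≤i _ → t≈0 {t = tri i} (ℕP.+-monoʳ-< m (s≤s m≤i)))))) ⟩
      c * (Q * centralAltSum m)
        ∎
      where
      c = coeff L k m
      Q = q^ (m ℕ.* m)
      t⁺ t⁻ : ℕ → Carrier
      t⁺ p = sign p * (q^ tri p * (m ℕ.+ m) C (m ℕ.+ p))
      t⁻ p = sign (suc p) * (q^ tri p * (m ℕ.+ m) C (m ℕ.+ suc p))
      factor : ∀ f → ∑ (suc n) (λ p → c * (Q * f p)) ≈ c * (Q * ∑ (suc n) f)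
      factor f = sym (trans (*-congˡ (*-distribˡ-∑ (suc n) Q f)) (*-distribˡ-∑ (suc n) c _))
      t≈0 : ∀ {i s t} → m ℕ.+ m < i → s * (q^ t * (m ℕ.+ m) C i) ≈ 0#
      t≈0 2m<i = trans (*-congˡ (trans (*-congˡ (C-above 2m<i)) (zeroʳ _))) (zeroʳ _)

  pent⁺ pent⁻ : ℕ → ℕ → ℕ → Carrier
  pent⁺ L n p = w⁺ p * (L C[ n ⊖ p ] * suc L C (n ℕ.+ suc p))
  pent⁻ L n p = w⁻ p * (suc L C[ n ⊖ p ] * L C (n ℕ.+ suc p))

  pentagonal-identity′ : ∀ L n → ∑ (suc n) (pent⁺ L n) + ∑ (suc n) (pent⁻ L n) ≈ L C n
  pentagonal-identity′ L n = begin
    ∑ (suc n) (pent⁺ L n) + ∑ (suc n) (pent⁻ L n)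
      ≈⟨ +-cong (trans (∑-cong (suc n) split⁺) (∑-distrib-+ (suc n) _ _)) (trans (∑-cong (suc n) split⁻) (∑-distrib-+ (suc n) _ _)) ⟩
    (∑ (suc n) d⁺ + ∑ (suc n) e⁺) + (∑ (suc n) d⁻ + ∑ (suc n) e⁻)
      ≈⟨ +-CS.interchange _ _ _ _ ⟩
    (∑ (suc n) d⁺ + ∑ (suc n) d⁻) + (∑ (suc n) e⁺ + ∑ (suc n) e⁻)
      ≈⟨ +-cong (pentagonal-identity L n) (trans (sym (∑-distrib-+ (suc n) e⁺ e⁻)) (∑-≈0 (suc n) (λ p p<1+n → cancel p (ℕP.≤-pred p<1+n)))) ⟩
    L C n + 0#
      ≈⟨ +-identityʳ _ ⟩
    L C n
      ∎
    where
    d⁺ d⁻ e⁺ e⁻ : ℕ → Carrier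
    d⁺ p = w⁺ p * (L C (n ℕ.+ p) * L C[ n ⊖ p ])
    d⁻ p = w⁻ p * (L C (n ℕ.+ suc p) * L C[ n ⊖ suc p ])
    e⁺ p = w⁺ p * ((q^ suc (n ℕ.+ p) * L C (n ℕ.+ suc p)) * L C[ n ⊖ p ])
    e⁻ p = w⁻ p * ((q^ (n ℕ.∸ p) * L C[ n ⊖ p ]) * L C (n ℕ.+ suc p))
    split⁺ : ∀ p → pent⁺ L n p ≈ d⁺ p + e⁺ p
    split⁺ p = begin
      w⁺ p * (L C[ n ⊖ p ] * suc L C (n ℕ.+ suc p))
        ≈⟨ *-congˡ (*-comm _ _) ⟩
      w⁺ p * (suc L C (n ℕ.+ suc p) * L C[ n ⊖ p ])
        ≈⟨ *-congˡ (*-congʳ (trans (C-congˡ (suc L) (ℕP.+-suc n p)) (+-congˡ (*-congˡ (C-congˡ L (P.sym (ℕP.+-suc n p))))))) ⟩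
      w⁺ p * ((L C (n ℕ.+ p) + q^ suc (n ℕ.+ p) * L C (n ℕ.+ suc p)) * L C[ n ⊖ p ])
        ≈⟨ trans (*-congˡ (distribʳ _ _ _)) (distribˡ _ _ _) ⟩
      d⁺ p + e⁺ p
        ∎
    split⁻ : ∀ p → pent⁻ L n p ≈ d⁻ p + e⁻ p
    split⁻ p = begin
      w⁻ p * (suc L C[ n ⊖ p ] * L C (n ℕ.+ suc p))
        ≈⟨ *-congˡ (*-congʳ (C⊖-pascal L n p)) ⟩
      w⁻ p * ((L C[ n ⊖ suc p ] + q^ (n ℕ.∸ p) * L C[ n ⊖ p ]) * L C (n ℕ.+ suc p))
        ≈⟨ trans (*-congˡ (distribʳ _ _ _)) (distribˡ _ _ _) ⟩
      w⁻ p * (L C[ n ⊖ suc p ] * L C (n ℕ.+ suc p)) + e⁻ p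
        ≈⟨ +-congʳ (*-congˡ (*-comm _ _)) ⟩
      d⁻ p + e⁻ p
        ∎
    cancel : ∀ p → p ≤ n → e⁺ p + e⁻ p ≈ 0#
    cancel p p≤n = trans (+-congˡ e⁻≈-e⁺) (-‿inverseʳ _)
      where
      rearrange⁺ : ∀ s a b x y → (s * a) * ((b * x) * y) ≈ s * ((a * b) * (y * x))
      rearrange⁺ = solve 5 (λ s a b x y → (s :* a) :* ((b :* x) :* y) := s :* ((a :* b) :* (y :* x))) refl
      rearrange⁻ : ∀ s a b x y → (s * a) * ((b * y) * x) ≈ s * ((a * b) * (y * x))
      rearrange⁻ = solve 5 (λ s a b x y → (s :* a) :* ((b :* y) :* x) := s :* ((a :* b) :* (y :* x))) refl
      E : ℕ
      E = p ℕ.* p ℕ.+ tri p ℕ.+ suc (n ℕ.+ p)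
      e⁺≈ : e⁺ p ≈ sign p * (q^ E * (L C[ n ⊖ p ] * L C (n ℕ.+ suc p)))
      e⁺≈ = trans (rearrange⁺ _ _ _ _ _) (*-congˡ (*-congʳ (sym (q^-+ (p ℕ.* p ℕ.+ tri p) (suc (n ℕ.+ p))))))
      e⁻≈-e⁺ : e⁻ p ≈ - e⁺ p
      e⁻≈-e⁺ = begin
        - sign p * q^ (suc p ℕ.* suc p ℕ.+ tri p) * ((q^ (n ℕ.∸ p) * L C[ n ⊖ p ]) * L C (n ℕ.+ suc p))
          ≈⟨ trans (*-congʳ (sym (-‿distribˡ-* _ _))) (sym (-‿distribˡ-* _ _)) ⟩
        - (sign p * q^ (suc p ℕ.* suc p ℕ.+ tri p) * ((q^ (n ℕ.∸ p) * L C[ n ⊖ p ]) * L C (n ℕ.+ suc p)))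
          ≈⟨ -‿cong (rearrange⁻ _ _ _ _ _) ⟩
        - (sign p * ((q^ (suc p ℕ.* suc p ℕ.+ tri p) * q^ (n ℕ.∸ p)) * (L C[ n ⊖ p ] * L C (n ℕ.+ suc p))))
          ≈⟨ -‿cong (*-congˡ (*-congʳ (trans (sym (q^-+ (suc p ℕ.* suc p ℕ.+ tri p) (n ℕ.∸ p))) (q^-cong (pentagonal-exponent (tri p) p≤n))))) ⟩
        - (sign p * (q^ E * (L C[ n ⊖ p ] * L C (n ℕ.+ suc p))))
          ≈⟨ -‿cong e⁺≈ ⟨
        - e⁺ p
          ∎

module BoxConvolution {r₁ r₂ : Level} (R : CommutativeRing r₁ r₂) (q : CommutativeRing.Carrier R) where
  open CommutativeRing R hiding (zero)
  open Sums R
  open QBinomials R q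
  open import Relation.Binary.Reasoning.Setoid setoid
  open import Algebra.Solver.Ring.NaturalCoefficients.Default commutativeSemiring
    using (solve; _:=_; _:*_)

  box : ℕ → ℕ → Carrier
  box K l = (K ℕ.+ l) C l

  box-pascal : ∀ K l → box (suc K) (suc l) ≈ box (suc K) l + q^ suc l * box K (suc l)
  box-pascal K l = +-congʳ (C-congʳ l (ℕP.+-suc K l))

  conv-box-suc : ∀ K n (a a′ : ℕ → Carrier) → (∀ k → a′ k ≈ q^ k * a k) →
    conv (suc n) (λ k l → a′ k * box (suc K) l)
      ≈ q^ suc n * conv (suc n) (λ k l → a k * box K l) + conv n (λ k l → a′ k * box (suc K) l)
  conv-box-suc K n a a′ a′≈ = begin
    a′ (suc n) * box (suc K) (n ℕ.∸ n) + ∑ (suc n) (λ k → a′ k * box (suc K) (suc n ℕ.∸ k))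
      ≈⟨ +-cong last (trans (∑-cong< (suc n) (λ k k<1+n → split k (ℕP.≤-pred k<1+n))) (∑-distrib-+ (suc n) _ _)) ⟩
    q^ suc n * (a (suc n) * box K (n ℕ.∸ n))
      + (conv n (λ k l → a′ k * box (suc K) l) + ∑ (suc n) (λ k → q^ suc n * (a k * box K (suc n ℕ.∸ k))))
      ≈⟨ +-CS.x∙yz≈y∙xz _ _ _ ⟩
    conv n (λ k l → a′ k * box (suc K) l)
      + (q^ suc n * (a (suc n) * box K (n ℕ.∸ n)) + ∑ (suc n) (λ k → q^ suc n * (a k * box K (suc n ℕ.∸ k))))
      ≈⟨ +-congˡ (trans (+-congˡ (sym (*-distribˡ-∑ (suc n) _ _))) (sym (distribˡ _ _ _))) ⟩
    conv n (λ k l → a′ k * box (suc K) l) + q^ suc n * conv (suc n) (λ k l → a k * box K l)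
      ≈⟨ +-comm _ _ ⟩
    q^ suc n * conv (suc n) (λ k l → a k * box K l) + conv n (λ k l → a′ k * box (suc K) l)
      ∎
    where
    last : a′ (suc n) * box (suc K) (n ℕ.∸ n) ≈ q^ suc n * (a (suc n) * box K (n ℕ.∸ n))
    last = begin
      a′ (suc n) * box (suc K) (n ℕ.∸ n)       ≡⟨ P.cong (λ z → a′ (suc n) * box (suc K) z) (ℕP.n∸n≡0 n) ⟩
      a′ (suc n) * box (suc K) 0               ≈⟨ *-congʳ (a′≈ (suc n)) ⟩
      (q^ suc n * a (suc n)) * 1#              ≈⟨ *-assoc _ _ _ ⟩
      q^ suc n * (a (suc n) * box K 0)         ≡⟨ P.cong (λ z → q^ suc n * (a (suc n) * box K z)) (ℕP.n∸n≡0 n) ⟨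
      q^ suc n * (a (suc n) * box K (n ℕ.∸ n)) ∎
    split : ∀ k → k ≤ n → a′ k * box (suc K) (suc n ℕ.∸ k)
                         ≈ a′ k * box (suc K) (n ℕ.∸ k) + q^ suc n * (a k * box K (suc n ℕ.∸ k))
    split k k≤n = begin
      a′ k * box (suc K) (suc n ℕ.∸ k)
        ≡⟨ P.cong (λ z → a′ k * box (suc K) z) 1+n∸k ⟩
      a′ k * box (suc K) (suc (n ℕ.∸ k))
        ≈⟨ trans (*-congˡ (box-pascal K (n ℕ.∸ k))) (distribˡ _ _ _) ⟩
      a′ k * box (suc K) (n ℕ.∸ k) + a′ k * (q^ suc (n ℕ.∸ k) * box K (suc (n ℕ.∸ k)))
        ≈⟨ +-congˡ (trans (*-congʳ (a′≈ k)) (rearrange _ _ _ _)) ⟩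
      a′ k * box (suc K) (n ℕ.∸ k) + (q^ k * q^ suc (n ℕ.∸ k)) * (a k * box K (suc (n ℕ.∸ k)))
        ≈⟨ +-congˡ (*-congʳ (trans (sym (q^-+ k (suc (n ℕ.∸ k)))) (q^-cong k+[1+n∸k]≡1+n))) ⟩
      a′ k * box (suc K) (n ℕ.∸ k) + q^ suc n * (a k * box K (suc (n ℕ.∸ k)))
        ≡⟨ P.cong (λ z → a′ k * box (suc K) (n ℕ.∸ k) + q^ suc n * (a k * box K z)) 1+n∸k ⟨
      a′ k * box (suc K) (n ℕ.∸ k) + q^ suc n * (a k * box K (suc n ℕ.∸ k))
        ∎
      where
      1+n∸k : suc n ℕ.∸ k ≡ suc (n ℕ.∸ k)
      1+n∸k = ℕP.+-∸-assoc 1 k≤n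
      k+[1+n∸k]≡1+n : k ℕ.+ suc (n ℕ.∸ k) ≡ suc n
      k+[1+n∸k]≡1+n = P.trans (ℕP.+-suc k (n ℕ.∸ k)) (P.cong suc (ℕP.m+[n∸m]≡n k≤n))
      rearrange : ∀ x a y b → (x * a) * (y * b) ≈ (x * y) * (a * b)
      rearrange = solve 4 (λ x a y b → (x :* a) :* (y :* b) := (x :* y) :* (a :* b)) refl

  boxWeight : ℕ → ℕ → ℕ → ℕ → Carrier
  boxWeight x y s k = q^ (k ℕ.* (k ℕ.+ s)) * (x C k * y C (k ℕ.+ s))

  boxConvolution : ℕ → ℕ → ℕ → ℕ → Carrier
  boxConvolution x y s n = conv n (λ k l → boxWeight x y s k * box (x ℕ.+ y) l)

  boxConvolution-suc : ∀ x y s n →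
    boxConvolution (suc x) y s (suc n) ≈ boxConvolution x (suc y) (suc s) n + q^ suc n * boxConvolution x y s (suc n)
  boxConvolution-suc x y s n = begin
    conv (suc n) (λ k l → boxWeight (suc x) y s k * box′ l)
      ≈⟨ conv-first n (λ k l → boxWeight (suc x) y s k * box′ l) ⟩
    boxWeight (suc x) y s 0 * box′ (suc n) + conv n (λ k l → boxWeight (suc x) y s (suc k) * box′ l)
      ≈⟨ +-congˡ (trans (conv-cong n split) (∑-distrib-+ (suc n) _ _)) ⟩
    boxWeight (suc x) y s 0 * box′ (suc n) + (conv n (λ k l → α k * box′ l) + conv n (λ k l → a′ (suc k) * box′ l))
      ≈⟨ trans (+-congˡ (+-comm _ _)) (sym (+-assoc _ _ _)) ⟩
    (boxWeight (suc x) y s 0 * box′ (suc n) + conv n (λ k l → a′ (suc k) * box′ l)) + conv n (λ k l → α k * box′ l)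
      ≈⟨ +-congʳ (sym (conv-first n (λ k l → a′ k * box′ l))) ⟩
    conv (suc n) (λ k l → a′ k * box′ l) + conv n (λ k l → α k * box′ l)
      ≈⟨ +-congʳ (conv-box-suc (x ℕ.+ y) n a a′ a′≈) ⟩
    (q^ suc n * boxConvolution x y s (suc n) + conv n (λ k l → a′ k * box′ l)) + conv n (λ k l → α k * box′ l)
      ≈⟨ trans (+-assoc _ _ _) (+-comm _ _) ⟩
    (conv n (λ k l → a′ k * box′ l) + conv n (λ k l → α k * box′ l)) + q^ suc n * boxConvolution x y s (suc n)
      ≈⟨ +-congʳ (trans (sym (∑-distrib-+ (suc n) _ _)) (conv-cong n (λ k l → trans (sym (distribʳ _ _ _)) (*-cong (sym (weight-suc k)) (sym (box-x+1+y l)))))) ⟩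
    boxConvolution x (suc y) (suc s) n + q^ suc n * boxConvolution x y s (suc n)
      ∎
    where
    box′ : ℕ → Carrier
    box′ = box (suc (x ℕ.+ y))
    a a′ α : ℕ → Carrier
    a = boxWeight x y s
    a′ k = q^ (k ℕ.* (k ℕ.+ s) ℕ.+ k) * (x C k * y C (k ℕ.+ s))
    α k = q^ (suc k ℕ.* (suc k ℕ.+ s)) * (x C k * y C (suc k ℕ.+ s))
    a′≈ : ∀ k → a′ k ≈ q^ k * a k
    a′≈ k = trans (*-congʳ (q^-+ (k ℕ.* (k ℕ.+ s)) k)) (trans (*-congʳ (*-comm _ _)) (*-assoc _ _ _))
    split : ∀ k l → boxWeight (suc x) y s (suc k) * box′ l ≈ α k * box′ l + a′ (suc k) * box′ l
    split k l = begin
      q^ e * ((x C k + q^ suc k * x C suc k) * y C (suc k ℕ.+ s)) * box′ l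
        ≈⟨ *-congʳ (trans (*-congˡ (distribʳ _ _ _)) (distribˡ _ _ _)) ⟩
      (α k + q^ e * ((q^ suc k * x C suc k) * y C (suc k ℕ.+ s))) * box′ l
        ≈⟨ *-congʳ (+-congˡ (trans (*-congˡ (*-assoc _ _ _)) (trans (sym (*-assoc _ _ _)) (*-congʳ (sym (q^-+ e (suc k))))))) ⟩
      (α k + a′ (suc k)) * box′ l
        ≈⟨ distribʳ _ _ _ ⟩
      α k * box′ l + a′ (suc k) * box′ l
        ∎
      where e = suc k ℕ.* (suc k ℕ.+ s)
    weight-suc : ∀ k → boxWeight x (suc y) (suc s) k ≈ a′ k + α k
    weight-suc k = begin
      q^ (k ℕ.* (k ℕ.+ suc s)) * (x C k * suc y C (k ℕ.+ suc s))
        ≈⟨ *-congˡ (*-congˡ (C-congˡ (suc y) (ℕP.+-suc k s))) ⟩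
      q^ (k ℕ.* (k ℕ.+ suc s)) * (x C k * (y C (k ℕ.+ s) + q^ suc (k ℕ.+ s) * y C suc (k ℕ.+ s)))
        ≈⟨ trans (*-congˡ (distribˡ _ _ _)) (distribˡ _ _ _) ⟩
      q^ (k ℕ.* (k ℕ.+ suc s)) * (x C k * y C (k ℕ.+ s))
        + q^ (k ℕ.* (k ℕ.+ suc s)) * (x C k * (q^ suc (k ℕ.+ s) * y C suc (k ℕ.+ s)))
        ≈⟨ +-cong (*-congʳ (q^-cong (e₁ k s))) (trans (rearrange _ _ _ _) (*-congʳ (trans (sym (q^-+ (k ℕ.* (k ℕ.+ suc s)) (suc (k ℕ.+ s)))) (q^-cong (e₂ k s))))) ⟩
      a′ k + α k
        ∎
      where
      e₁ : ∀ k s → k ℕ.* (k ℕ.+ suc s) ≡ k ℕ.* (k ℕ.+ s) ℕ.+ k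
      e₁ = solve-∀
      e₂ : ∀ k s → k ℕ.* (k ℕ.+ suc s) ℕ.+ suc (k ℕ.+ s) ≡ suc k ℕ.* (suc k ℕ.+ s)
      e₂ = solve-∀
      rearrange : ∀ p r a b → p * (a * (r * b)) ≈ (p * r) * (a * b)
      rearrange = solve 4 (λ p r a b → p :* (a :* (r :* b)) := (p :* r) :* (a :* b)) refl
    box-x+1+y : ∀ l → box (x ℕ.+ suc y) l ≈ box′ l
    box-x+1+y l = reflexive (P.cong (λ z → box z l) (ℕP.+-suc x y))

  box-product : ∀ x y s n → box (x ℕ.+ s) n * (y ℕ.+ n) C (n ℕ.+ s) ≈ boxConvolution x y s n
  box-product zero y s n = begin
    (s ℕ.+ n) C n * (y ℕ.+ n) C (n ℕ.+ s)
      ≈⟨ *-cong (C-congʳ n (ℕP.+-comm s n)) (C-congʳ (n ℕ.+ s) (ℕP.+-comm y n)) ⟩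
    (n ℕ.+ s) C n * (n ℕ.+ y) C (n ℕ.+ s)
      ≈⟨ C-revision′ n s y ⟨
    (n ℕ.+ y) C n * y C s
      ≈⟨ trans (*-comm _ _) (*-cong (sym (trans (*-identityˡ _) (*-identityˡ _))) (C-congʳ n (ℕP.+-comm n y))) ⟩
    boxWeight 0 y s 0 * box y n
      ≈⟨ +-identityʳ _ ⟨
    boxWeight 0 y s 0 * box y n + 0#
      ≈⟨ +-congˡ (∑-≈0 n (λ k _ → trans (*-congʳ (trans (*-congˡ (zeroˡ _)) (zeroʳ _))) (zeroˡ _))) ⟨
    boxWeight 0 y s 0 * box y (n ℕ.∸ 0) + ∑ n (λ k → boxWeight 0 y s (suc k) * box y (n ℕ.∸ suc k))
      ≈⟨ ∑-first n _ ⟨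
    boxConvolution zero y s n
      ∎
  box-product (suc x) y s zero = begin
    1# * (y ℕ.+ 0) C s                                ≈⟨ *-identityˡ _ ⟩
    (y ℕ.+ 0) C s                                     ≈⟨ C-congʳ s (ℕP.+-identityʳ y) ⟩
    y C s                                             ≈⟨ trans (*-identityˡ _) (*-identityˡ _) ⟨
    q^ 0 * (1# * y C s)                               ≈⟨ *-identityʳ _ ⟨
    q^ 0 * (1# * y C s) * 1#                          ≈⟨ +-identityʳ _ ⟨
    boxConvolution (suc x) y s zero                   ∎
  box-product (suc x) y s (suc n) = begin
    box (suc (x ℕ.+ s)) (suc n) * (y ℕ.+ suc n) C (suc n ℕ.+ s)
      ≈⟨ trans (*-congʳ (box-pascal (x ℕ.+ s) n)) (trans (distribʳ _ _ _) (+-congˡ (*-assoc _ _ _))) ⟩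
    box (suc (x ℕ.+ s)) n * (y ℕ.+ suc n) C (suc n ℕ.+ s) + q^ suc n * (box (x ℕ.+ s) (suc n) * (y ℕ.+ suc n) C (suc n ℕ.+ s))
      ≈⟨ +-cong (trans (*-cong (reflexive (P.cong (λ z → box z n) (P.sym (ℕP.+-suc x s))))
                               (C-cong (ℕP.+-suc y n) (P.sym (ℕP.+-suc n s)))) (box-product x (suc y) (suc s) n))
                (*-congˡ (box-product x y s (suc n))) ⟩
    boxConvolution x (suc y) (suc s) n + q^ suc n * boxConvolution x y s (suc n)
      ≈⟨ boxConvolution-suc x y s n ⟨
    boxConvolution (suc x) y s (suc n)
      ∎

module Summands {r₁ r₂ : Level} (R : CommutativeRing r₁ r₂) (q : CommutativeRing.Carrier R) where
  open CommutativeRing R hiding (zero)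
  open Q R q
  open Sums R
  open QBinomials R q
  open Arithmetic
  open AlternatingSums R q using (sign)
  open PentagonalIdentity R q
  open BoxConvolution R q
  open ℤ using (+_; -[1+_])
  open import Algebra.Properties.Ring ring using (-‿involutive)
  open import Relation.Binary.Reasoning.Setoid setoid
  open import Algebra.Solver.Ring.NaturalCoefficients.Default commutativeSemiring
    using (solve; _:=_; _:*_)

  -- The local recursion of sumSym is recovered by unification from the equations of ∑-unique.
  sumSym≡∑ : ∀ K f → sumSym K f ≡ ∑ (suc (K ℕ.+ K)) (λ i → f (+ i ℤ.- + K))
  sumSym≡∑ K f with K ℕ.+ K | ∑-unique (λ i → f (+ i ℤ.- + K)) _ P.refl (λ m → P.refl)
  ... | n | sumSym-go≡∑ = P.cong (λ s → f (+ n ℤ.- + K) + s) (sumSym-go≡∑ n)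

  sumSym-split : ∀ K f → sumSym K f ≈ ∑ (suc K) (λ p → f (+ p)) + ∑ K (λ p → f -[1+ p ])
  sumSym-split K f = begin
    sumSym K f                                          ≡⟨ sumSym≡∑ K f ⟩
    ∑ (suc (K ℕ.+ K)) g                                 ≡⟨ P.cong (λ n → ∑ n g) (ℕP.+-suc K K) ⟨
    ∑ (K ℕ.+ suc K) g                                   ≈⟨ ∑-split K (suc K) g ⟩
    ∑ K g + ∑ (suc K) (λ p → g (K ℕ.+ p))               ≈⟨ +-cong (trans (∑-reverse K g) (∑-cong< K (λ p p<K → reflexive (P.cong f (negative p p<K)))))
                                                                  (∑-cong (suc K) (λ p → reflexive (P.cong f (nonnegative p)))) ⟩
    ∑ K (λ p → f -[1+ p ]) + ∑ (suc K) (λ p → f (+ p))  ≈⟨ +-comm _ _ ⟩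
    ∑ (suc K) (λ p → f (+ p)) + ∑ K (λ p → f -[1+ p ])  ∎
    where
    g : ℕ → Carrier
    g i = f (+ i ℤ.- + K)
    nonnegative : ∀ p → + (K ℕ.+ p) ℤ.- + K ≡ + p
    nonnegative p = cancel (+ K) (+ p)
      where
      cancel : ∀ x y → (x ℤ.+ y) ℤ.- x ≡ y
      cancel = ℤ-Solver.solve-∀
    negative : ∀ p → p < K → + (K ℕ.∸ suc p) ℤ.- + K ≡ -[1+ p ]
    negative p p<K = P.trans (P.cong (λ k → + (K ℕ.∸ suc p) ℤ.- + k) (P.sym (ℕP.m∸n+n≡m p<K))) (cancel (+ (K ℕ.∸ suc p)) (+ p))
      where
      cancel : ∀ x y → x ℤ.- (x ℤ.+ (ℤ.+ 1 ℤ.+ y)) ≡ ℤ.- (ℤ.+ 1 ℤ.+ y)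
      cancel = ℤ-Solver.solve-∀

  sumTo≈∑ : ∀ K f → sumTo K f ≈ ∑ (suc K) f
  sumTo≈∑ zero f = sym (+-identityʳ _)
  sumTo≈∑ (suc K) f = +-congˡ (sumTo≈∑ K f)

  sgn≈sign : ∀ p → sgn (+ p) ≈ sign p
  sgn≈sign zero = refl
  sgn≈sign (suc zero) = refl
  sgn≈sign (suc (suc p)) = trans (sgn≈sign p) (sym (-‿involutive _))

  rhsBinomial : ℕ → ℕ → ℕ → Carrier
  rhsBinomial L M n = gauss (+ (2 ℕ.* L ℕ.+ M) ℤ.- + n) (+ (2 ℕ.* L ℕ.+ 1))

  rhsWeight : ℕ → ℕ → ℕ → Carrier
  rhsWeight L M n = q^ (n ℕ.* suc n) * rhsBinomial L M n

  rhsBinomial-vanish : ∀ L M n → M ≤ n → rhsBinomial L M n ≈ 0#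
  rhsBinomial-vanish L M n M≤n with n ℕP.≤? 2 ℕ.* L ℕ.+ M
  ... | yes n≤2L+M with ℕP.m≤n⇒∃[o]m+o≡n n≤2L+M
  ...   | d , n+d≡2L+M = begin
    gauss (+ (2 ℕ.* L ℕ.+ M) ℤ.- + n) (+ (2 ℕ.* L ℕ.+ 1))   ≡⟨ P.cong (λ z → gauss (+ z ℤ.- + n) (+ (2 ℕ.* L ℕ.+ 1))) n+d≡2L+M ⟨
    gauss (+ (n ℕ.+ d) ℤ.- + n) (+ (2 ℕ.* L ℕ.+ 1))         ≡⟨ P.cong (λ z → gauss z (+ (2 ℕ.* L ℕ.+ 1))) (cancel (+ n) (+ d)) ⟩
    d C (2 ℕ.* L ℕ.+ 1)                                      ≈⟨ C-above d<2L+1 ⟩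
    0#                                                       ∎
    where
    cancel : ∀ x y → (x ℤ.+ y) ℤ.- x ≡ y
    cancel = ℤ-Solver.solve-∀
    d≤2L : d ≤ 2 ℕ.* L
    d≤2L = ℕP.+-cancelʳ-≤ M d (2 ℕ.* L)
             (P.subst (d ℕ.+ M ≤_) (P.trans (ℕP.+-comm d n) n+d≡2L+M) (ℕP.+-monoʳ-≤ d M≤n))
    d<2L+1 : d < 2 ℕ.* L ℕ.+ 1
    d<2L+1 = P.subst (d <_) (ℕP.+-comm 1 (2 ℕ.* L)) (s≤s d≤2L)
  rhsBinomial-vanish L M n M≤n | no n≰2L+M with ℕP.m≤n⇒∃[o]m+o≡n (ℕP.≰⇒> n≰2L+M)
  ...   | d , P.refl = reflexive (P.cong (λ z → gauss z (+ (2 ℕ.* L ℕ.+ 1))) (overshoot (+ (2 ℕ.* L ℕ.+ M)) (+ d)))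
    where
    overshoot : ∀ x y → x ℤ.- (ℤ.+ 1 ℤ.+ x ℤ.+ y) ≡ ℤ.- (ℤ.+ 1 ℤ.+ y)
    overshoot = ℤ-Solver.solve-∀

  rhsWeight-vanish : ∀ L M n → M ≤ n → rhsWeight L M n ≈ 0#
  rhsWeight-vanish L M n M≤n = trans (*-congˡ (rhsBinomial-vanish L M n M≤n)) (zeroʳ _)

  rhsBinomial≈box : ∀ L p N k → k ≤ N → rhsBinomial L (suc (p ℕ.+ N)) (p ℕ.+ k) ≈ box (suc (2 ℕ.* L)) (N ℕ.∸ k)
  rhsBinomial≈box L p N k k≤N with ℕP.m≤n⇒∃[o]m+o≡n k≤N
  ... | r , P.refl = begin
    gauss (+ (2 ℕ.* L ℕ.+ suc (p ℕ.+ (k ℕ.+ r))) ℤ.- + (p ℕ.+ k)) (+ (2 ℕ.* L ℕ.+ 1))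
      ≡⟨ P.cong (λ z → gauss (+ z ℤ.- + (p ℕ.+ k)) (+ (2 ℕ.* L ℕ.+ 1))) (regroup L p k r) ⟩
    gauss (+ (suc (2 ℕ.* L) ℕ.+ r ℕ.+ (p ℕ.+ k)) ℤ.- + (p ℕ.+ k)) (+ (2 ℕ.* L ℕ.+ 1))
      ≡⟨ P.cong (λ z → gauss z (+ (2 ℕ.* L ℕ.+ 1))) (cancel (+ (suc (2 ℕ.* L) ℕ.+ r)) (+ (p ℕ.+ k))) ⟩
    (suc (2 ℕ.* L) ℕ.+ r) C (2 ℕ.* L ℕ.+ 1)
      ≈⟨ C-congˡ (suc (2 ℕ.* L) ℕ.+ r) (ℕP.+-comm (2 ℕ.* L) 1) ⟩
    (suc (2 ℕ.* L) ℕ.+ r) C suc (2 ℕ.* L)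
      ≈⟨ C-sym (suc (2 ℕ.* L)) r ⟩
    box (suc (2 ℕ.* L)) r
      ≡⟨ P.cong (box (suc (2 ℕ.* L))) (ℕP.m+n∸m≡n k r) ⟨
    box (suc (2 ℕ.* L)) (k ℕ.+ r ℕ.∸ k)
      ∎
    where
    regroup : ∀ L p k r → 2 ℕ.* L ℕ.+ suc (p ℕ.+ (k ℕ.+ r)) ≡ suc (2 ℕ.* L) ℕ.+ r ℕ.+ (p ℕ.+ k)
    regroup = solve-∀
    cancel : ∀ x y → (x ℤ.+ y) ℤ.- y ≡ x
    cancel = ℤ-Solver.solve-∀

  -- The factor q^(p(p+1)) of the summand and the weight q^(k(k+2p+1)) of box-product combine into
  -- q^(n(n+1)) with n = p + k.
  lhs-expansion : ∀ L x y p N s t K → x ℕ.+ y ≡ suc (2 ℕ.* L) → suc (p ℕ.+ N) ≤ K →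
    (s * q^ (p ℕ.* suc p ℕ.+ t)) * (box (x ℕ.+ suc (p ℕ.+ p)) N * (y ℕ.+ N) C (N ℕ.+ suc (p ℕ.+ p)))
      ≈ ∑ (suc K) (λ n → rhsWeight L (suc (p ℕ.+ N)) n * ((s * q^ t) * (x C[ n ⊖ p ] * y C (n ℕ.+ suc p))))
  lhs-expansion L x y p N s t K x+y≡2L+1 M≤K = begin
    (s * E) * (box (x ℕ.+ 2p+1) N * (y ℕ.+ N) C (N ℕ.+ 2p+1))
      ≈⟨ *-congˡ (box-product x y 2p+1 N) ⟩
    (s * E) * boxConvolution x y 2p+1 N
      ≈⟨ *-distribˡ-∑ (suc N) _ _ ⟩
    ∑ (suc N) (λ k → (s * E) * (boxWeight x y 2p+1 k * box (x ℕ.+ y) (N ℕ.∸ k)))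
      ≈⟨ ∑-cong< (suc N) (λ k k<1+N → term k (ℕP.≤-pred k<1+N)) ⟩
    ∑ (suc N) (λ k → g (p ℕ.+ k))
      ≈⟨ ∑-window (suc K) p (suc N) g p+1+N≤1+K below above ⟨
    ∑ (suc K) g
      ∎
    where
    2p+1 = suc (p ℕ.+ p)
    M = suc (p ℕ.+ N)
    E = q^ (p ℕ.* suc p ℕ.+ t)
    g : ℕ → Carrier
    g n = rhsWeight L M n * ((s * q^ t) * (x C[ n ⊖ p ] * y C (n ℕ.+ suc p)))
    p+1+N≡M : p ℕ.+ suc N ≡ M
    p+1+N≡M = ℕP.+-suc p N
    p+1+N≤1+K : p ℕ.+ suc N ≤ suc K
    p+1+N≤1+K = P.subst (_≤ suc K) (P.sym p+1+N≡M) (ℕP.m≤n⇒m≤1+n M≤K)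
    below : ∀ n → n < p → g n ≈ 0#
    below n n<p = trans (*-congˡ (trans (*-congˡ (trans (*-congʳ (C⊖-< x n p n<p)) (zeroˡ _))) (zeroʳ _))) (zeroʳ _)
    above : ∀ n → p ℕ.+ suc N ≤ n → g n ≈ 0#
    above n M≤n = trans (*-congʳ (rhsWeight-vanish L M n (P.subst (_≤ n) p+1+N≡M M≤n))) (zeroˡ _)
    term : ∀ k → k ≤ N → (s * E) * (boxWeight x y 2p+1 k * box (x ℕ.+ y) (N ℕ.∸ k)) ≈ g (p ℕ.+ k)
    term k k≤N = begin
      (s * E) * ((q^ (k ℕ.* (k ℕ.+ 2p+1)) * (x C k * y C (k ℕ.+ 2p+1))) * box (x ℕ.+ y) (N ℕ.∸ k))
        ≈⟨ rearrange₁ _ _ _ _ _ _ ⟩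
      s * ((E * q^ (k ℕ.* (k ℕ.+ 2p+1))) * ((x C k * y C (k ℕ.+ 2p+1)) * box (x ℕ.+ y) (N ℕ.∸ k)))
        ≈⟨ *-congˡ (*-congʳ exponent) ⟩
      s * ((q^ (n ℕ.* suc n) * q^ t) * ((x C k * y C (k ℕ.+ 2p+1)) * box (x ℕ.+ y) (N ℕ.∸ k)))
        ≈⟨ rearrange₂ _ _ _ _ _ _ ⟩
      (q^ (n ℕ.* suc n) * box (x ℕ.+ y) (N ℕ.∸ k)) * ((s * q^ t) * (x C k * y C (k ℕ.+ 2p+1)))
        ≈⟨ *-cong (*-congˡ (trans (reflexive (P.cong (λ z → box z (N ℕ.∸ k)) x+y≡2L+1)) (sym (rhsBinomial≈box L p N k k≤N))))
                  (*-congˡ (*-cong (sym (C⊖-≥ x p k)) (C-congˡ y (regroup p k)))) ⟩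
      g n
        ∎
      where
      n = p ℕ.+ k
      complete-square : ∀ p k t → p ℕ.* suc p ℕ.+ t ℕ.+ k ℕ.* (k ℕ.+ suc (p ℕ.+ p)) ≡ (p ℕ.+ k) ℕ.* suc (p ℕ.+ k) ℕ.+ t
      complete-square = solve-∀
      exponent : E * q^ (k ℕ.* (k ℕ.+ 2p+1)) ≈ q^ (n ℕ.* suc n) * q^ t
      exponent = trans (sym (q^-+ (p ℕ.* suc p ℕ.+ t) _)) (trans (q^-cong (complete-square p k t)) (q^-+ (n ℕ.* suc n) t))
      regroup : ∀ p k → k ℕ.+ suc (p ℕ.+ p) ≡ p ℕ.+ k ℕ.+ suc p
      regroup = solve-∀
      rearrange₁ : ∀ s e w a b h → (s * e) * ((w * (a * b)) * h) ≈ s * ((e * w) * ((a * b) * h))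
      rearrange₁ = solve 6 (λ s e w a b h → (s :* e) :* ((w :* (a :* b)) :* h) := s :* ((e :* w) :* ((a :* b) :* h))) refl
      rearrange₂ : ∀ s u v a b h → s * ((u * v) * ((a * b) * h)) ≈ (u * h) * ((s * v) * (a * b))
      rearrange₂ = solve 6 (λ s u v a b h → s :* ((u :* v) :* ((a :* b) :* h)) := (u :* h) :* ((s :* v) :* (a :* b))) refl

  ∑-rhsWeight-vanish : ∀ L M K p (f : ℕ → Carrier) → M ≤ p → (∀ n → n < p → f n ≈ 0#) →
                       ∑ (suc K) (λ n → rhsWeight L M n * f n) ≈ 0#
  ∑-rhsWeight-vanish L M K p f M≤p f≈0 = ∑-≈0 (suc K) term≈0
    where
    term≈0 : ∀ n → n < suc K → rhsWeight L M n * f n ≈ 0#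
    term≈0 n _ with n ℕP.<? p
    ... | yes n<p = trans (*-congˡ (f≈0 n n<p)) (zeroʳ _)
    ... | no n≮p = trans (*-congʳ (rhsWeight-vanish L M n (ℕP.≤-trans M≤p (ℕP.≮⇒≥ n≮p)))) (zeroˡ _)

  lhsTerm-+ : ∀ L M K p → M ≤ K → lhsTerm L M (+ p) ≈ ∑ (suc K) (λ n → rhsWeight L M n * pent⁺ L n p)
  lhsTerm-+ L M K p M≤K with suc p ℕP.≤? M
  ... | no p≮M with ℕP.m≤n⇒∃[o]m+o≡n (ℕP.≤-pred (ℕP.≰⇒> p≮M))
  ...   | d , P.refl = begin
    lhsTerm L M (+ (M ℕ.+ d))
      ≈⟨ trans (*-congʳ (trans (*-congˡ (reflexive (P.cong (gauss (+ (L ℕ.+ M ℕ.+ (M ℕ.+ d)))) (overshoot (+ M) (+ d))))) (zeroʳ _))) (zeroˡ _) ⟩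
    0#
      ≈⟨ ∑-rhsWeight-vanish L M K (M ℕ.+ d) _ (ℕP.m≤m+n M d) (λ n n<p → trans (*-congˡ (trans (*-congʳ (C⊖-< L n _ n<p)) (zeroˡ _))) (zeroʳ _)) ⟨
    ∑ (suc K) (λ n → rhsWeight L M n * pent⁺ L n (M ℕ.+ d))
      ∎
    where
    overshoot : ∀ x y → x ℤ.- (x ℤ.+ y) ℤ.- ℤ.+ 1 ≡ ℤ.- (ℤ.+ 1 ℤ.+ y)
    overshoot = ℤ-Solver.solve-∀
  lhsTerm-+ L M K p M≤K | yes p<M with ℕP.m≤n⇒∃[o]m+o≡n p<M
  ...   | N , P.refl = begin
    lhsTerm L M (+ p)
      ≈⟨ *-cong (*-cong (*-cong (sgn≈sign p) (q^-cong (expo-+ p))) (reflexive (P.cong (gauss (+ (L ℕ.+ M ℕ.+ p))) (lower (+ p) (+ N)))))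
                (reflexive (P.cong (λ z → gauss z (+ (M ℕ.+ p))) (upper (+ L) (+ p) (+ N)))) ⟩
    (sign p * q^ (p ℕ.* suc p ℕ.+ (p ℕ.* p ℕ.+ tri p))) * (L ℕ.+ M ℕ.+ p) C N * (L ℕ.+ suc N) C (M ℕ.+ p)
      ≈⟨ trans (*-assoc _ _ _) (*-congˡ (*-cong (C-congʳ N (e₁ L p N)) (C-cong (ℕP.+-suc L N) (e₂ p N)))) ⟩
    (sign p * q^ (p ℕ.* suc p ℕ.+ (p ℕ.* p ℕ.+ tri p))) * (box (L ℕ.+ suc (p ℕ.+ p)) N * (suc L ℕ.+ N) C (N ℕ.+ suc (p ℕ.+ p)))
      ≈⟨ lhs-expansion L L (suc L) p N (sign p) (p ℕ.* p ℕ.+ tri p) K (L+1+L L) M≤K ⟩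
    ∑ (suc K) (λ n → rhsWeight L M n * pent⁺ L n p)
      ∎
    where
    lower : ∀ x y → (ℤ.+ 1 ℤ.+ x ℤ.+ y) ℤ.- x ℤ.- ℤ.+ 1 ≡ y
    lower = ℤ-Solver.solve-∀
    upper : ∀ l x y → (l ℤ.+ (ℤ.+ 1 ℤ.+ x ℤ.+ y)) ℤ.- x ≡ l ℤ.+ (ℤ.+ 1 ℤ.+ y)
    upper = ℤ-Solver.solve-∀
    e₁ : ∀ L p N → L ℕ.+ suc (p ℕ.+ N) ℕ.+ p ≡ L ℕ.+ suc (p ℕ.+ p) ℕ.+ N
    e₁ = solve-∀
    e₂ : ∀ p N → suc (p ℕ.+ N) ℕ.+ p ≡ N ℕ.+ suc (p ℕ.+ p)
    e₂ = solve-∀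
    L+1+L : ∀ L → L ℕ.+ suc L ≡ suc (2 ℕ.* L)
    L+1+L = solve-∀

  lhsTerm-[1+] : ∀ L M K p → M ≤ K → lhsTerm L M -[1+ p ] ≈ ∑ (suc K) (λ n → rhsWeight L M n * pent⁻ L n p)
  lhsTerm-[1+] L M K p M≤K with suc p ℕP.≤? M
  ... | no p≮M with ℕP.m≤n⇒∃[o]m+o≡n (ℕP.≤-pred (ℕP.≰⇒> p≮M))
  ...   | d , P.refl = begin
    lhsTerm L M -[1+ M ℕ.+ d ]
      ≈⟨ trans (*-congˡ (reflexive (P.cong (gauss (+ (L ℕ.+ M ℕ.+ suc (M ℕ.+ d)))) (overshoot (+ M) (+ d))))) (zeroʳ _) ⟩
    0#
      ≈⟨ ∑-rhsWeight-vanish L M K (M ℕ.+ d) _ (ℕP.m≤m+n M d) (λ n n<p → trans (*-congˡ (trans (*-congʳ (C⊖-< (suc L) n _ n<p)) (zeroˡ _))) (zeroʳ _)) ⟨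
    ∑ (suc K) (λ n → rhsWeight L M n * pent⁻ L n (M ℕ.+ d))
      ∎
    where
    overshoot : ∀ x y → x ℤ.+ ℤ.- (ℤ.+ 1 ℤ.+ (x ℤ.+ y)) ≡ ℤ.- (ℤ.+ 1 ℤ.+ y)
    overshoot = ℤ-Solver.solve-∀
  lhsTerm-[1+] L M K p M≤K | yes p<M with ℕP.m≤n⇒∃[o]m+o≡n p<M
  ...   | N , P.refl = begin
    lhsTerm L M -[1+ p ]
      ≈⟨ *-cong (*-cong (*-cong (sgn≈sign (suc p)) (q^-cong (expo-[1+] p)))
                        (reflexive (P.cong₂ gauss (upper (+ L) (+ p) (+ N)) (shift (+ M) (+ p)))))
                (reflexive (P.cong (gauss (+ (L ℕ.+ M ℕ.+ suc p))) (lower (+ p) (+ N)))) ⟩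
    (sign (suc p) * q^ (p ℕ.* suc p ℕ.+ (suc p ℕ.* suc p ℕ.+ tri p))) * (L ℕ.+ N) C (M ℕ.+ p) * (L ℕ.+ M ℕ.+ suc p) C N
      ≈⟨ trans (*-assoc _ _ _) (*-congˡ (trans (*-comm _ _) (*-cong (C-congʳ N (e₁ L p N)) (C-congˡ (L ℕ.+ N) (e₂ p N))))) ⟩
    (sign (suc p) * q^ (p ℕ.* suc p ℕ.+ (suc p ℕ.* suc p ℕ.+ tri p)))
      * (box (suc L ℕ.+ suc (p ℕ.+ p)) N * (L ℕ.+ N) C (N ℕ.+ suc (p ℕ.+ p)))
      ≈⟨ lhs-expansion L (suc L) L p N (sign (suc p)) (suc p ℕ.* suc p ℕ.+ tri p) K (1+L+L L) M≤K ⟩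
    ∑ (suc K) (λ n → rhsWeight L M n * pent⁻ L n p)
      ∎
    where
    upper : ∀ l x y → l ℤ.+ (ℤ.+ 1 ℤ.+ x ℤ.+ y) ℤ.+ ℤ.- (ℤ.+ 1 ℤ.+ x) ≡ l ℤ.+ y
    upper = ℤ-Solver.solve-∀
    shift : ∀ m x → m ℤ.+ (ℤ.+ 1 ℤ.+ x) ℤ.- ℤ.+ 1 ≡ m ℤ.+ x
    shift = ℤ-Solver.solve-∀
    lower : ∀ x y → ℤ.+ 1 ℤ.+ x ℤ.+ y ℤ.+ ℤ.- (ℤ.+ 1 ℤ.+ x) ≡ y
    lower = ℤ-Solver.solve-∀
    e₁ : ∀ L p N → L ℕ.+ suc (p ℕ.+ N) ℕ.+ suc p ≡ suc L ℕ.+ suc (p ℕ.+ p) ℕ.+ N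
    e₁ = solve-∀
    e₂ : ∀ p N → suc (p ℕ.+ N) ℕ.+ p ≡ N ℕ.+ suc (p ℕ.+ p)
    e₂ = solve-∀
    1+L+L : ∀ L → suc L ℕ.+ L ≡ suc (2 ℕ.* L)
    1+L+L = solve-∀

  pentagonal-sum : ∀ L M K n → M ≤ K → n ≤ K →
    ∑ (suc K) (λ p → rhsWeight L M n * pent⁺ L n p) + ∑ K (λ p → rhsWeight L M n * pent⁻ L n p)
      ≈ rhsWeight L M n * L C n
  pentagonal-sum L M K n M≤K n≤K = begin
    ∑ (suc K) (λ p → c * pent⁺ L n p) + ∑ K (λ p → c * pent⁻ L n p)
      ≈⟨ +-cong (*-distribˡ-∑ (suc K) c _) (*-distribˡ-∑ K c _) ⟨
    c * ∑ (suc K) (pent⁺ L n) + c * ∑ K (pent⁻ L n)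
      ≈⟨ distribˡ _ _ _ ⟨
    c * (∑ (suc K) (pent⁺ L n) + ∑ K (pent⁻ L n))
      ≈⟨ factored (n ℕP.<? K) ⟩
    c * L C n
      ∎
    where
    c = rhsWeight L M n
    factored : Dec (n < K) → c * (∑ (suc K) (pent⁺ L n) + ∑ K (pent⁻ L n)) ≈ c * L C n
    factored (yes n<K) = *-congˡ (begin
      ∑ (suc K) (pent⁺ L n) + ∑ K (pent⁻ L n)
        ≈⟨ +-cong (∑-trim _ (ℕP.m≤n⇒m≤1+n n<K) (λ p n<p _ → trans (*-congˡ (trans (*-congʳ (C⊖-< L n p n<p)) (zeroˡ _))) (zeroʳ _)))
                  (∑-trim _ n<K (λ p n<p _ → trans (*-congˡ (trans (*-congʳ (C⊖-< (suc L) n p n<p)) (zeroˡ _))) (zeroʳ _))) ⟩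
      ∑ (suc n) (pent⁺ L n) + ∑ (suc n) (pent⁻ L n)
        ≈⟨ pentagonal-identity′ L n ⟩
      L C n
        ∎)
    factored (no n≮K) = trans (*-congʳ c≈0) (trans (zeroˡ _) (sym (trans (*-congʳ c≈0) (zeroˡ _))))
      where
      c≈0 : c ≈ 0#
      c≈0 = rhsWeight-vanish L M n (ℕP.≤-trans M≤K (ℕP.≮⇒≥ n≮K))

  sumSym-lhsTerm≈sumTo-rhsTerm : ∀ L M K → M ≤ K → sumSym K (lhsTerm L M) ≈ sumTo K (rhsTerm L M)
  sumSym-lhsTerm≈sumTo-rhsTerm L M K M≤K = begin
    sumSym K (lhsTerm L M)
      ≈⟨ sumSym-split K (lhsTerm L M) ⟩
    ∑ (suc K) (λ p → lhsTerm L M (+ p)) + ∑ K (λ p → lhsTerm L M -[1+ p ])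
      ≈⟨ +-cong (∑-cong (suc K) (λ p → lhsTerm-+ L M K p M≤K)) (∑-cong K (λ p → lhsTerm-[1+] L M K p M≤K)) ⟩
    ∑ (suc K) (λ p → ∑ (suc K) (λ n → w n * pent⁺ L n p)) + ∑ K (λ p → ∑ (suc K) (λ n → w n * pent⁻ L n p))
      ≈⟨ +-cong (∑-comm (suc K) (suc K) _) (∑-comm K (suc K) _) ⟩
    ∑ (suc K) (λ n → ∑ (suc K) (λ p → w n * pent⁺ L n p)) + ∑ (suc K) (λ n → ∑ K (λ p → w n * pent⁻ L n p))
      ≈⟨ ∑-distrib-+ (suc K) _ _ ⟨
    ∑ (suc K) (λ n → ∑ (suc K) (λ p → w n * pent⁺ L n p) + ∑ K (λ p → w n * pent⁻ L n p))
      ≈⟨ ∑-cong< (suc K) (λ n n<1+K → pentagonal-sum L M K n M≤K (ℕP.≤-pred n<1+K)) ⟩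
    ∑ (suc K) (λ n → w n * L C n)
      ≈⟨ sumTo≈∑ K (rhsTerm L M) ⟨
    sumTo K (rhsTerm L M)
      ∎
    where
    w = rhsWeight L M

open import Data.Nat using (_+_)

lemma3p2 : ∀ {c ℓ : Level} (R : CommutativeRing c ℓ) (q : CommutativeRing.Carrier R)
             (L M K : ℕ) → L + M ≤ K →
             CommutativeRing._≈_ R (Q.sumSym R q K (Q.lhsTerm R q L M))
                                   (Q.sumTo R q K (Q.rhsTerm R q L M))
lemma3p2 R q L M K L+M≤K = Summands.sumSym-lhsTerm≈sumTo-rhsTerm R q L M K (ℕP.m+n≤o⇒n≤o L L+M≤K)
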